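{- There are two functions $h_{\nu}:(0,1)\to\left(0,\frac12\right]$ and $h_{\delta}:(0,1)\times\left(0,\frac12\right]\to(0,1)$ with the following property: if $\epsilon\in(0,1)$, $\nu\in(0,h_\nu(\epsilon))$, and $G$ is a graph of order $n$, size $m$, and matching number $\nu n$ such that $h_\delta(\epsilon,\nu)n\geq 1$ and $m\geq m(n,\nu)-h_\delta(\epsilon,\nu)n^2$, then $G$ has at least $\lceil(1-\epsilon)n\rceil^{\underline{\lceil(1-\epsilon)\nu n\rceil}}$ maximum matchings.
   Context: Graphs are finite, simple and undirected. The matching number of $G$ is the largest size of a matching in $G$; a maximum matching is a matching of that size. For an integer $n\ge1$ and real $\nu\in[0,\frac12]$ with $\nu n$ an integer, define $m(n,\nu)=\nu n(n-\nu n)+\binom{\nu n}{2}$ if $\nu\leq\frac25-\frac{3}{5n}$, and $m(n,\nu)=\binom{2\nu n+1}{2}$ if $\frac25-\frac{3}{5n}\leq\nu\leq\frac12$. For positive integers $N\ge K$, the falling factorial is $N^{\underline{K}}=N(N-1)\cdots(N-K+1)$.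
   Formalization: The parameter ε ranges over the rationals, and the functions $h_{\nu}$ and $h_{\delta}$ are defined on rational arguments and take values in ℚ. -}

module Defs where

open import Data.Bool using (Bool; true; false; if_then_else_)
open import Data.Nat using (ℕ; zero; suc; _+_; _*_; _∸_; _≤ᵇ_)
open import Data.Nat.Combinatorics using (_C_)
open import Data.Fin using (Fin; toℕ; _<_)
open import Data.Integer using (+_)
open import Data.Rational using (ℚ; _/_)
open import Relation.Binary.PropositionalEquality using (_≡_)

ℕ→ℚ : ℕ → ℚ
ℕ→ℚ n = + n / 1

sumFin : (n : ℕ) → (Fin n → ℕ) → ℕ
sumFin zero    f = 0
sumFin (suc n) f = f Fin.zero + sumFin n (λ i → f (Fin.suc i))

record Graph (n : ℕ) : Set where
  field
    adj       : Fin n → Fin n → Bool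
    symmetric : ∀ u v → adj u v ≡ adj v u
    irreflexive : ∀ u → adj u u ≡ false

edgeCount : (n : ℕ) → (Fin n → Fin n → Bool) → ℕ
edgeCount n A = sumFin n (λ u → sumFin n (λ v →
  if suc (toℕ u) ≤ᵇ toℕ v then (if A u v then 1 else 0) else 0))

size : ∀ {n} → Graph n → ℕ
size {n} G = edgeCount n (Graph.adj G)

record IsMatching {n : ℕ} (G : Graph n) (M : Fin n → Fin n → Bool) : Set where
  field
    subgraph  : ∀ u v → M u v ≡ true → Graph.adj G u v ≡ true
    symmetric : ∀ u v → M u v ≡ M v u
    atMostOne : ∀ u v w → M u v ≡ true → M u w ≡ true → v ≡ w

matchingSize : ∀ {n} → (Fin n → Fin n → Bool) → ℕ
matchingSize {n} M = edgeCount n M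

record HasMatchingNumber {n : ℕ} (G : Graph n) (k : ℕ) : Set where
  field
    witness  : Fin n → Fin n → Bool
    isMatch  : IsMatching G witness
    sizeEq   : matchingSize witness ≡ k
    maximal  : ∀ M → IsMatching G M → matchingSize M Data.Nat.≤ k

record IsMaximumMatching {n : ℕ} (G : Graph n) (M : Fin n → Fin n → Bool) : Set where
  field
    isMatch : IsMatching G M
    maximum : ∀ M' → IsMatching G M' → matchingSize M' Data.Nat.≤ matchingSize M

-- m(n,ν) with k = ν n :
--   k(n-k) + C(k,2)   if ν ≤ 2/5 - 3/(5n), i.e. 5k + 3 ≤ 2n
--   C(2k+1,2)         otherwise
-- (both formulas agree on the boundary 5k + 3 = 2n)
mExt : ℕ → ℕ → ℕ
mExt n k = if (5 * k + 3) ≤ᵇ (2 * n)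
           then k * (n ∸ k) + (k C 2)
           else (suc (2 * k)) C 2

{-# OPTIONS --safe #-}
module Submission where

-- Let M be a maximum matching (k edges). Its unmatched vertices are independent, and for a matching edge ab,
-- if a has two unmatched neighbours then b has none, since otherwise x a b y would be an augmenting path.
-- Call a matched vertex heavy if it has more than t = A + 2 unmatched neighbours, where A = ⌈(1 - ε)n⌉.
-- Counting edges at matched pairs gives 2m + 2k ≤ 2H(n - 2k) + t(2k - 2H) + 4k², where H is the number of
-- heavy vertices; when m is within δn² of m(n, ν) this forces H ≥ B = ⌈(1 - ε)k⌉. Swapping the matching edges
-- at B heavy vertices, one after another, to unmatched neighbours not used before gives at least
-- (A + 3)(A + 2)⋯(A + 4 - B) ≥ A(A - 1)⋯(A - B + 1) different maximum matchings.

open import Defs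

module MaximumMatchings where

  open import Data.Bool using (Bool; true; false; if_then_else_; _∧_; _∨_; not)
  open import Data.Bool.Properties using (∨-comm; ∧-comm; ∨-identityʳ; ∧-zeroʳ; T-≡)
  open import Data.Empty using (⊥; ⊥-elim)
  open import Data.Fin as Fin using (Fin; zero; suc; toℕ; remQuot)
  import Data.Fin.Properties as Fin
  open import Data.Fin.Permutation using (permutation)
  open import Data.Nat
  open import Data.Nat.Properties
  open import Data.Nat.Combinatorics using (_P_)
  open import Data.Nat.Combinatorics.Base using (_P′_)
  open import Data.Nat.Tactic.RingSolver using (solve-∀)
  open import Data.List using (List; []; _∷_; length; tabulate)
  open import Data.List.Properties using (length-tabulate)
  open import Data.List.Relation.Unary.All using (All; []; _∷_)
  open import Data.List.Relation.Unary.AllPairs using (AllPairs; []; _∷_)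
  import Data.List.Relation.Unary.All.Properties as All
  import Data.List.Relation.Unary.AllPairs.Properties as AllPairs
  open import Data.Product using (Σ; ∃; _×_; _,_; proj₁; proj₂)
  open import Data.Sum using (_⊎_; inj₁; inj₂)
  open import Function using (_∘_; Equivalence)
  open import Relation.Nullary using (¬_; yes; no)
  open import Relation.Nullary.Decidable using (dec-true; dec-false)
  open import Relation.Binary.Definitions using (tri<; tri≈; tri>)
  open import Relation.Binary.PropositionalEquality
  open import Algebra.Properties.CommutativeMonoid.Sum +-0-commutativeMonoid
    using (sum; ∑-distrib-+; ∑-comm; sum-permute; sum-cong-≗)
  open import Algebra.Properties.Semiring.Sum +-*-semiring using (*-distribˡ-sum)

  -- Finite sums and counting

  sumFin≡sum : ∀ n (f : Fin n → ℕ) → sumFin n f ≡ sum f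
  sumFin≡sum zero    f = refl
  sumFin≡sum (suc n) f = cong (f zero +_) (sumFin≡sum n (f ∘ suc))

  sum-mono-≤ : ∀ {n} {f g : Fin n → ℕ} → (∀ i → f i ≤ g i) → sum f ≤ sum g
  sum-mono-≤ {zero}  f≤g = z≤n
  sum-mono-≤ {suc n} f≤g = +-mono-≤ (f≤g zero) (sum-mono-≤ (f≤g ∘ suc))

  sum-mono-< : ∀ {n} {f g : Fin n → ℕ} j → (∀ i → f i ≤ g i) → f j < g j → sum f < sum g
  sum-mono-< zero    f≤g fj<gj = +-mono-<-≤ fj<gj (sum-mono-≤ (f≤g ∘ suc))
  sum-mono-< (suc j) f≤g fj<gj = +-mono-≤-< (f≤g zero) (sum-mono-< j (f≤g ∘ suc) fj<gj)

  term≤sum : ∀ {n} (f : Fin n → ℕ) j → f j ≤ sum f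
  term≤sum f zero    = m≤m+n (f zero) _
  term≤sum f (suc j) = ≤-trans (term≤sum (f ∘ suc) j) (m≤n+m _ (f zero))

  sum-*ˡ : ∀ {n} c (f : Fin n → ℕ) → sum (λ i → c * f i) ≡ c * sum f
  sum-*ˡ c f = sym (*-distribˡ-sum c f)

  sum-involution : ∀ {n} (p : Fin n → Fin n) → (∀ i → p (p i) ≡ i) → (f : Fin n → ℕ) →
                   sum (f ∘ p) ≡ sum f
  sum-involution p inv f = sym (sum-permute f (permutation p p inv inv))

  ≤⇒≤ᵇ≡true : ∀ {m n} → m ≤ n → (m ≤ᵇ n) ≡ true
  ≤⇒≤ᵇ≡true m≤n = dec-true (_ ≤? _) m≤n

  ≰⇒≤ᵇ≡false : ∀ {m n} → ¬ m ≤ n → (m ≤ᵇ n) ≡ false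
  ≰⇒≤ᵇ≡false m≰n = dec-false (_ ≤? _) m≰n

  Bool→ℕ : Bool → ℕ
  Bool→ℕ b = if b then 1 else 0

  ∧≡true : ∀ {a b} → (a ∧ b) ≡ true → a ≡ true × b ≡ true
  ∧≡true {true} {true} _ = refl , refl

  Bool→ℕ-mono : ∀ {a b} → (a ≡ true → b ≡ true) → Bool→ℕ a ≤ Bool→ℕ b
  Bool→ℕ-mono {false} a⇒b = z≤n
  Bool→ℕ-mono {true}  a⇒b rewrite a⇒b refl = ≤-refl

  Bool→ℕ≤1 : ∀ b → Bool→ℕ b ≤ 1
  Bool→ℕ≤1 false = z≤n
  Bool→ℕ≤1 true  = ≤-refl

  count : ∀ {n} → (Fin n → Bool) → ℕ
  count Q = sum (Bool→ℕ ∘ Q)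

  _==_ : ∀ {n} → Fin n → Fin n → Bool
  zero  == zero  = true
  zero  == suc _ = false
  suc _ == zero  = false
  suc i == suc j = i == j

  ==-refl : ∀ {n} (i : Fin n) → (i == i) ≡ true
  ==-refl zero    = refl
  ==-refl (suc i) = ==-refl i

  ==⇒≡ : ∀ {n} (i j : Fin n) → (i == j) ≡ true → i ≡ j
  ==⇒≡ zero    zero    _ = refl
  ==⇒≡ (suc i) (suc j) e = cong suc (==⇒≡ i j e)

  ≢⇒==-false : ∀ {n} (i j : Fin n) → i ≢ j → (i == j) ≡ false
  ≢⇒==-false zero    zero    i≢j = ⊥-elim (i≢j refl)
  ≢⇒==-false zero    (suc j) _   = refl
  ≢⇒==-false (suc i) zero    _   = refl
  ≢⇒==-false (suc i) (suc j) i≢j = ≢⇒==-false i j (i≢j ∘ cong suc)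

  count-false : ∀ {n} (Q : Fin n → Bool) → (∀ i → Q i ≡ false) → count Q ≡ 0
  count-false {zero}  Q none = refl
  count-false {suc n} Q none rewrite none zero = count-false (Q ∘ suc) (none ∘ suc)

  count-== : ∀ {n} (j : Fin n) → count (_== j) ≡ 1
  count-== {suc n} zero = cong suc (count-false {n} _ (λ _ → refl))
  count-== (suc j)      = count-== j

  count-witness : ∀ {n} (Q : Fin n → Bool) → 1 ≤ count Q → ∃ λ i → Q i ≡ true
  count-witness {suc n} Q 1≤c with Q zero in eq
  ... | true  = zero , eq
  ... | false = let i , Qi = count-witness (Q ∘ suc) 1≤c in suc i , Qi

  count-witness-≢ : ∀ {n} (Q : Fin n → Bool) → 2 ≤ count Q → ∀ y → ∃ λ i → Q i ≡ true × i ≢ y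
  count-witness-≢ {suc n} Q 2≤c zero with Q zero
  ... | true  = let i , Qi = count-witness (Q ∘ suc) (≤-pred 2≤c) in suc i , Qi , λ ()
  ... | false = let i , Qi = count-witness (Q ∘ suc) (≤-trans (s≤s z≤n) 2≤c) in suc i , Qi , λ ()
  count-witness-≢ {suc n} Q 2≤c (suc y) with Q zero in eq
  ... | true  = zero , eq , λ ()
  ... | false = let i , Qi , i≢y = count-witness-≢ (Q ∘ suc) 2≤c y in suc i , Qi , i≢y ∘ Fin.suc-injective

  count-≤1 : ∀ {n} (Q : Fin n → Bool) → (∀ i j → Q i ≡ true → Q j ≡ true → i ≡ j) → count Q ≤ 1
  count-≤1 {zero}  Q unique = z≤n
  count-≤1 {suc n} Q unique with Q zero in eq
  ... | true  = ≤-reflexive (cong suc (count-false (Q ∘ suc) rest-false))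
    where
    rest-false : ∀ i → Q (suc i) ≡ false
    rest-false i with Q (suc i) in eq′
    ... | true  with () ← unique zero (suc i) eq eq′
    ... | false = refl
  ... | false = count-≤1 (Q ∘ suc) (λ i j Qi Qj → Fin.suc-injective (unique (suc i) (suc j) Qi Qj))

  search : ∀ {n} (Q : Fin n → Bool) → (∃ λ i → Q i ≡ true) ⊎ (∀ i → Q i ≡ false)
  search {zero}  Q = inj₂ λ ()
  search {suc n} Q with Q zero in eq | search (Q ∘ suc)
  ... | true  | _            = inj₁ (zero , eq)
  ... | false | inj₁ (i , e) = inj₁ (suc i , e)
  ... | false | inj₂ none    = inj₂ λ { zero → eq ; (suc i) → none i }

  -- Matchings

  Adj : ℕ → Set
  Adj n = Fin n → Fin n → Bool

  deg : ∀ {n} → Adj n → Fin n → ℕ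
  deg R v = count (R v)

  free : ∀ {n} → Adj n → Fin n → Bool
  free M v = deg M v ≡ᵇ 0

  free-intro : ∀ {n} (M : Adj n) v → (∀ w → M v w ≡ false) → free M v ≡ true
  free-intro M v none rewrite count-false (M v) none = refl

  free⇒no-edge : ∀ {n} (M : Adj n) v → free M v ≡ true → ∀ w → M v w ≡ false
  free⇒no-edge M v fv w with M v w in e
  ... | false = refl
  ... | true with deg M v | term≤sum (Bool→ℕ ∘ M v) w
  ...   | zero | 1≤0 rewrite e with () ← 1≤0
  ...   | suc _ | _ with () ← fv

  edge⇒not-free : ∀ {n} (M : Adj n) v w → M v w ≡ true → free M v ≡ false
  edge⇒not-free M v w e with free M v in fv
  ... | false = refl
  ... | true with () ← trans (sym e) (free⇒no-edge M v fv w)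

  free-≢ : ∀ {n} (M : Adj n) x y → free M x ≡ true → free M y ≡ false → x ≢ y
  free-≢ M x y fx fy refl with () ← trans (sym fx) fy

  upper : ∀ {n} → Adj n → Fin n → Fin n → ℕ
  upper R u v = if suc (toℕ u) ≤ᵇ toℕ v then Bool→ℕ (R u v) else 0

  Bool→ℕ≡upper+upper : ∀ {n} (R : Adj n) → (∀ u v → R u v ≡ R v u) → (∀ u → R u u ≡ false) →
                       ∀ u v → Bool→ℕ (R u v) ≡ upper R u v + upper R v u
  Bool→ℕ≡upper+upper R R-sym irr u v with <-cmp (toℕ u) (toℕ v)
  ... | tri< u<v _ v≮u rewrite ≤⇒≤ᵇ≡true u<v | ≰⇒≤ᵇ≡false v≮u = sym (+-identityʳ _)
  ... | tri> u≮v _ v<u rewrite ≤⇒≤ᵇ≡true v<u | ≰⇒≤ᵇ≡false u≮v | R-sym u v = refl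
  ... | tri≈ _ u≡v _ with refl ← Fin.toℕ-injective u≡v rewrite irr u | ≰⇒≤ᵇ≡false (n≮n (toℕ u)) = refl

  handshake : ∀ {n} (R : Adj n) → (∀ u v → R u v ≡ R v u) → (∀ u → R u u ≡ false) →
              sum (deg R) ≡ 2 * edgeCount n R
  handshake {n} R R-sym irr = begin
      sum (λ u → sum (λ v → Bool→ℕ (R u v)))
    ≡⟨ sum-cong-≗ (λ u → sum-cong-≗ (Bool→ℕ≡upper+upper R R-sym irr u)) ⟩
      sum (λ u → sum (λ v → upper R u v + upper R v u))
    ≡⟨ sum-cong-≗ (λ u → ∑-distrib-+ (upper R u) (λ v → upper R v u)) ⟩
      sum (λ u → sum (upper R u) + sum (λ v → upper R v u))
    ≡⟨ ∑-distrib-+ (λ u → sum (upper R u)) (λ u → sum (λ v → upper R v u)) ⟩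
      sum (λ u → sum (upper R u)) + sum (λ u → sum (λ v → upper R v u))
    ≡⟨ cong (sum (λ u → sum (upper R u)) +_) (∑-comm (λ u v → upper R v u)) ⟩
      sum (λ u → sum (upper R u)) + sum (λ u → sum (upper R u))
    ≡⟨ cong (λ e → e + e) edgeCount≡sum ⟨
      edgeCount n R + edgeCount n R
    ≡⟨ cong (edgeCount n R +_) (+-identityʳ _) ⟨
      2 * edgeCount n R
    ∎
    where
    open ≡-Reasoning
    edgeCount≡sum : edgeCount n R ≡ sum (λ u → sum (upper R u))
    edgeCount≡sum = trans (sumFin≡sum n _) (sum-cong-≗ (λ u → sumFin≡sum n (upper R u)))

  module _ {n : ℕ} (G : Graph n) where
    open Graph G renaming (symmetric to adj-sym)
    open IsMatching

    matching-deg≤1 : ∀ {M} → IsMatching G M → ∀ v → deg M v ≤ 1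
    matching-deg≤1 M-match v = count-≤1 _ (atMostOne M-match v)

    matching-deg≡1 : ∀ {M} → IsMatching G M → ∀ v w → M v w ≡ true → deg M v ≡ 1
    matching-deg≡1 {M} M-match v w e =
      ≤-antisym (matching-deg≤1 M-match v) (subst (λ b → Bool→ℕ b ≤ deg M v) e (term≤sum _ w))

    matching-deg≡covered : ∀ {M} → IsMatching G M → ∀ v → Bool→ℕ (not (free M v)) ≡ deg M v
    matching-deg≡covered {M} M-match v with deg M v | matching-deg≤1 M-match v
    ... | zero        | _ = refl
    ... | suc zero    | _ = refl
    ... | suc (suc _) | s≤s ()

    matching-irreflexive : ∀ {M} → IsMatching G M → ∀ v → M v v ≡ false
    matching-irreflexive {M} M-match v with M v v in e
    ... | false = refl
    ... | true  = trans (sym (subgraph M-match v v e)) (irreflexive v)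

    adj⇒≢ : ∀ u w → adj u w ≡ true → u ≢ w
    adj⇒≢ u w e refl with () ← trans (sym e) (irreflexive u)

    matching-size-double : ∀ {M} → IsMatching G M → sum (deg M) ≡ 2 * matchingSize M
    matching-size-double M-match = handshake _ (symmetric M-match) (matching-irreflexive M-match)

    edge : Fin n → Fin n → Adj n
    edge u w x y = (x == u ∧ y == w) ∨ (x == w ∧ y == u)

    edge-sym : ∀ u w x y → edge u w x y ≡ edge u w y x
    edge-sym u w x y = trans (∨-comm (x == u ∧ y == w) (x == w ∧ y == u)) (cong₂ _∨_ (∧-comm (x == w) (y == u)) (∧-comm (x == u) (y == w)))

    addEdge : Adj n → Fin n → Fin n → Adj n
    addEdge M u w x y = edge u w x y ∨ M x y

    module Augment {M : Adj n} (M-match : IsMatching G M) (u w : Fin n)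
                   (u-free : free M u ≡ true) (w-free : free M w ≡ true) (uw : adj u w ≡ true) where
      open ≡-Reasoning

      M⁺ : Adj n
      M⁺ = addEdge M u w

      u≢w : u ≢ w
      u≢w = adj⇒≢ u w uw

      row-u : ∀ y → M⁺ u y ≡ (y == w)
      row-u y rewrite ==-refl u | ≢⇒==-false u w u≢w | free⇒no-edge M u u-free y = trans (∨-identityʳ _) (∨-identityʳ (y == w))

      row-w : ∀ y → M⁺ w y ≡ (y == u)
      row-w y rewrite ==-refl w | ≢⇒==-false w u (u≢w ∘ sym) | free⇒no-edge M w w-free y = ∨-identityʳ (y == u)

      row-other : ∀ x y → x ≢ u → x ≢ w → M⁺ x y ≡ M x y
      row-other x y x≢u x≢w rewrite ≢⇒==-false x u x≢u | ≢⇒==-false x w x≢w = refl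

      isMatching : IsMatching G M⁺
      isMatching = record { subgraph = M⁺⊆adj ; symmetric = M⁺-sym ; atMostOne = M⁺-atMostOne }
        where
        M⁺⊆adj : ∀ x y → M⁺ x y ≡ true → adj x y ≡ true
        M⁺⊆adj x y e with x Fin.≟ u | x Fin.≟ w
        ... | yes refl | _ with refl ← ==⇒≡ y w (trans (sym (row-u y)) e) = uw
        ... | no _ | yes refl with refl ← ==⇒≡ y u (trans (sym (row-w y)) e) = trans (adj-sym w u) uw
        ... | no x≢u | no x≢w = subgraph M-match x y (trans (sym (row-other x y x≢u x≢w)) e)
        M⁺-sym : ∀ x y → M⁺ x y ≡ M⁺ y x
        M⁺-sym x y = cong₂ _∨_ (edge-sym u w x y) (symmetric M-match x y)
        M⁺-atMostOne : ∀ x y z → M⁺ x y ≡ true → M⁺ x z ≡ true → y ≡ z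
        M⁺-atMostOne x y z e e′ with x Fin.≟ u | x Fin.≟ w
        ... | yes refl | _ = trans (==⇒≡ y w (trans (sym (row-u y)) e)) (sym (==⇒≡ z w (trans (sym (row-u z)) e′)))
        ... | no _ | yes refl = trans (==⇒≡ y u (trans (sym (row-w y)) e)) (sym (==⇒≡ z u (trans (sym (row-w z)) e′)))
        ... | no x≢u | no x≢w = atMostOne M-match x y z (trans (sym (row-other x y x≢u x≢w)) e)
                                                      (trans (sym (row-other x z x≢u x≢w)) e′)

      u-deg0 : deg M u ≡ 0
      u-deg0 = count-false (M u) (free⇒no-edge M u u-free)

      w-deg0 : deg M w ≡ 0
      w-deg0 = count-false (M w) (free⇒no-edge M w w-free)

      deg-M⁺ : ∀ x → deg M⁺ x ≡ deg M x + (Bool→ℕ (x == u) + Bool→ℕ (x == w))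
      deg-M⁺ x with x Fin.≟ u | x Fin.≟ w
      ... | yes refl | _ = begin
          deg M⁺ u                                    ≡⟨ sum-cong-≗ (cong Bool→ℕ ∘ row-u) ⟩
          count (_== w)                               ≡⟨ count-== w ⟩
          1                                           ≡⟨ cong₂ (λ d b → d + (1 + Bool→ℕ b)) u-deg0 (≢⇒==-false u w u≢w) ⟨
          deg M u + (1 + Bool→ℕ (u == w))             ≡⟨ cong (λ b → deg M u + (Bool→ℕ b + Bool→ℕ (u == w))) (==-refl u) ⟨
          deg M u + (Bool→ℕ (u == u) + Bool→ℕ (u == w)) ∎
      ... | no w≢u | yes refl = begin
          deg M⁺ w                                    ≡⟨ sum-cong-≗ (cong Bool→ℕ ∘ row-w) ⟩
          count (_== u)                               ≡⟨ count-== u ⟩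
          1                                           ≡⟨ cong₂ (λ d b → d + (Bool→ℕ b + 1)) w-deg0 (≢⇒==-false w u w≢u) ⟨
          deg M w + (Bool→ℕ (w == u) + 1)             ≡⟨ cong (λ b → deg M w + (Bool→ℕ (w == u) + Bool→ℕ b)) (==-refl w) ⟨
          deg M w + (Bool→ℕ (w == u) + Bool→ℕ (w == w)) ∎
      ... | no x≢u | no x≢w = begin
          deg M⁺ x                                    ≡⟨ sum-cong-≗ (λ y → cong Bool→ℕ (row-other x y x≢u x≢w)) ⟩
          deg M x                                     ≡⟨ +-identityʳ (deg M x) ⟨
          deg M x + 0                                 ≡⟨ cong₂ (λ b b′ → deg M x + (Bool→ℕ b + Bool→ℕ b′))
                                                               (≢⇒==-false x u x≢u) (≢⇒==-false x w x≢w) ⟨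
          deg M x + (Bool→ℕ (x == u) + Bool→ℕ (x == w)) ∎

      size-M⁺ : matchingSize M⁺ ≡ suc (matchingSize M)
      size-M⁺ = *-cancelˡ-≡ _ _ 2 (begin
          2 * matchingSize M⁺                                      ≡⟨ matching-size-double isMatching ⟨
          sum (deg M⁺)                                             ≡⟨ sum-cong-≗ deg-M⁺ ⟩
          sum (λ x → deg M x + (Bool→ℕ (x == u) + Bool→ℕ (x == w))) ≡⟨ ∑-distrib-+ (deg M) _ ⟩
          sum (deg M) + sum (λ x → Bool→ℕ (x == u) + Bool→ℕ (x == w)) ≡⟨ cong (sum (deg M) +_) endpoints ⟩
          sum (deg M) + 2                                          ≡⟨ cong (_+ 2) (matching-size-double M-match) ⟩
          2 * matchingSize M + 2                                   ≡⟨ +-comm (2 * matchingSize M) 2 ⟩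
          2 + 2 * matchingSize M                                   ≡⟨ *-distribˡ-+ 2 1 (matchingSize M) ⟨
          2 * suc (matchingSize M)                                 ∎)
        where
        endpoints : sum (λ x → Bool→ℕ (x == u) + Bool→ℕ (x == w)) ≡ 2
        endpoints = trans (∑-distrib-+ (λ x → Bool→ℕ (x == u)) _) (cong₂ _+_ (count-== u) (count-== w))

    swapEdge : Adj n → Fin n → Fin n → Fin n → Adj n
    swapEdge M a b c x y = if edge a b x y then false else (edge a c x y ∨ M x y)

    module Swap {M : Adj n} (M-match : IsMatching G M) (a b c : Fin n)
                (ab : M a b ≡ true) (c-free : free M c ≡ true) (ac : adj a c ≡ true) where
      open ≡-Reasoning

      M′ : Adj n
      M′ = swapEdge M a b c

      ba : M b a ≡ true
      ba = trans (symmetric M-match b a) ab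

      a≢b : a ≢ b
      a≢b refl with () ← trans (sym ab) (matching-irreflexive M-match a)

      a≢c : a ≢ c
      a≢c = free-≢ M c a c-free (edge⇒not-free M a b ab) ∘ sym

      b≢c : b ≢ c
      b≢c = free-≢ M c b c-free (edge⇒not-free M b a ba) ∘ sym

      only-partner : ∀ {x x′} → M x x′ ≡ true → ∀ y → y ≢ x′ → M x y ≡ false
      only-partner {x} xx′ y y≢x′ with M x y in e
      ... | false = refl
      ... | true  = ⊥-elim (y≢x′ (atMostOne M-match x y _ e xx′))

      row-a : ∀ y → M′ a y ≡ (y == c)
      row-a y with y Fin.≟ b
      ... | yes refl rewrite ==-refl a | ≢⇒==-false a b a≢b | ==-refl b | ≢⇒==-false b c b≢c = refl
      ... | no y≢b rewrite ==-refl a | ≢⇒==-false a b a≢b | ≢⇒==-false y b y≢b | ≢⇒==-false a c a≢c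
                         | only-partner ab y y≢b with y == c
      ...   | true  = refl
      ...   | false = refl

      row-b : ∀ y → M′ b y ≡ false
      row-b y with y Fin.≟ a
      ... | yes refl rewrite ==-refl b | ≢⇒==-false b y (a≢b ∘ sym) | ==-refl y = refl
      ... | no y≢a rewrite ==-refl b | ≢⇒==-false b a (a≢b ∘ sym) | ≢⇒==-false y a y≢a
                         | ≢⇒==-false b c b≢c | only-partner ba y y≢a = refl

      row-c : ∀ y → M′ c y ≡ (y == a)
      row-c y rewrite ==-refl c | ≢⇒==-false c a (a≢c ∘ sym) | ≢⇒==-false c b (b≢c ∘ sym)
                    | free⇒no-edge M c c-free y with y == a
      ... | true  = refl
      ... | false = refl

      row-other : ∀ x y → x ≢ a → x ≢ b → x ≢ c → M′ x y ≡ M x y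
      row-other x y x≢a x≢b x≢c rewrite ≢⇒==-false x a x≢a | ≢⇒==-false x b x≢b | ≢⇒==-false x c x≢c = refl

      isMatching : IsMatching G M′
      isMatching = record { subgraph = M′⊆adj ; symmetric = M′-sym ; atMostOne = M′-atMostOne }
        where
        M′⊆adj : ∀ x y → M′ x y ≡ true → adj x y ≡ true
        M′⊆adj x y e with x Fin.≟ a | x Fin.≟ b | x Fin.≟ c
        ... | yes refl | _ | _ with refl ← ==⇒≡ y c (trans (sym (row-a y)) e) = ac
        ... | no _ | yes refl | _ with () ← trans (sym (row-b y)) e
        ... | no _ | no _ | yes refl with refl ← ==⇒≡ y a (trans (sym (row-c y)) e) = trans (adj-sym c a) ac
        ... | no x≢a | no x≢b | no x≢c = subgraph M-match x y (trans (sym (row-other x y x≢a x≢b x≢c)) e)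
        M′-sym : ∀ x y → M′ x y ≡ M′ y x
        M′-sym x y rewrite edge-sym a b x y | edge-sym a c x y | symmetric M-match x y = refl
        M′-atMostOne : ∀ x y z → M′ x y ≡ true → M′ x z ≡ true → y ≡ z
        M′-atMostOne x y z e e′ with x Fin.≟ a | x Fin.≟ b | x Fin.≟ c
        ... | yes refl | _ | _ = trans (==⇒≡ y c (trans (sym (row-a y)) e)) (sym (==⇒≡ z c (trans (sym (row-a z)) e′)))
        ... | no _ | yes refl | _ with () ← trans (sym (row-b y)) e
        ... | no _ | no _ | yes refl = trans (==⇒≡ y a (trans (sym (row-c y)) e)) (sym (==⇒≡ z a (trans (sym (row-c z)) e′)))
        ... | no x≢a | no x≢b | no x≢c = atMostOne M-match x y z (trans (sym (row-other x y x≢a x≢b x≢c)) e)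
                                                                (trans (sym (row-other x z x≢a x≢b x≢c)) e′)

      deg-M′ : ∀ x → deg M′ x + Bool→ℕ (x == b) ≡ deg M x + Bool→ℕ (x == c)
      deg-M′ x with x Fin.≟ a | x Fin.≟ b | x Fin.≟ c
      ... | yes refl | _ | _ = cong₂ _+_
          (trans (sum-cong-≗ (cong Bool→ℕ ∘ row-a)) (trans (count-== c) (sym (matching-deg≡1 M-match a b ab))))
          (cong Bool→ℕ (trans (≢⇒==-false a b a≢b) (sym (≢⇒==-false a c a≢c))))
      ... | no _ | yes refl | _ = begin
          deg M′ b + Bool→ℕ (b == b) ≡⟨ cong₂ (λ d e → d + Bool→ℕ e) (count-false (M′ b) row-b) (==-refl b) ⟩
          1                          ≡⟨ cong₂ (λ d e → d + Bool→ℕ e) (matching-deg≡1 M-match b a ba) (≢⇒==-false b c b≢c) ⟨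
          deg M b + Bool→ℕ (b == c)  ∎
      ... | no c≢a | no c≢b | yes refl = begin
          deg M′ c + Bool→ℕ (c == b) ≡⟨ cong₂ (λ d e → d + Bool→ℕ e)
                                             (trans (sum-cong-≗ (cong Bool→ℕ ∘ row-c)) (count-== a)) (≢⇒==-false c b c≢b) ⟩
          1                          ≡⟨ cong₂ (λ d e → d + Bool→ℕ e) (count-false (M c) (free⇒no-edge M c c-free)) (==-refl c) ⟨
          deg M c + Bool→ℕ (c == c)  ∎
      ... | no x≢a | no x≢b | no x≢c = cong₂ _+_
          (sum-cong-≗ (λ y → cong Bool→ℕ (row-other x y x≢a x≢b x≢c)))
          (cong Bool→ℕ (trans (≢⇒==-false x b x≢b) (sym (≢⇒==-false x c x≢c))))

      size-M′ : matchingSize M′ ≡ matchingSize M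
      size-M′ = *-cancelˡ-≡ _ _ 2 (+-cancelʳ-≡ _ _ _ (begin
          2 * matchingSize M′ + 1                         ≡⟨ cong₂ _+_ (matching-size-double isMatching) (count-== b) ⟨
          sum (deg M′) + count (_== b)                    ≡⟨ ∑-distrib-+ (deg M′) _ ⟨
          sum (λ x → deg M′ x + Bool→ℕ (x == b))          ≡⟨ sum-cong-≗ deg-M′ ⟩
          sum (λ x → deg M x + Bool→ℕ (x == c))           ≡⟨ ∑-distrib-+ (deg M) _ ⟩
          sum (deg M) + count (_== c)                     ≡⟨ cong₂ _+_ (matching-size-double M-match) (count-== c) ⟩
          2 * matchingSize M + 1                          ∎))

      b-free : free M′ b ≡ true
      b-free = free-intro M′ b row-b

      stays-free : ∀ z → free M z ≡ true → z ≢ c → free M′ z ≡ true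
      stays-free z z-free z≢c = free-intro M′ z λ y →
        trans (row-other z y (free-≢ M z a z-free (edge⇒not-free M a b ab))
                             (free-≢ M z b z-free (edge⇒not-free M b a ba)) z≢c)
              (free⇒no-edge M z z-free y)

      keeps : ∀ x y → M x y ≡ true → x ≢ a → x ≢ b → M′ x y ≡ true
      keeps x y xy x≢a x≢b = trans (row-other x y x≢a x≢b (free-≢ M c x c-free (edge⇒not-free M x y xy) ∘ sym)) xy

      has-ac : M′ a c ≡ true
      has-ac = trans (row-a c) (==-refl c)

  -- Many maximum matchings by successive swaps

  fallingFactorial : ℕ → ℕ → ℕ
  fallingFactorial c zero    = 1
  fallingFactorial c (suc l) = c * fallingFactorial (pred c) l

  fallingFactorial≡P′ : ∀ c l → fallingFactorial c l ≡ c P′ l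
  fallingFactorial≡P′ c zero    = refl
  fallingFactorial≡P′ c (suc l) = begin
    c * fallingFactorial (pred c) l  ≡⟨ cong (c *_) (fallingFactorial≡P′ (pred c) l) ⟩
    c * (pred c P′ l)                ≡⟨ P′-peel c l ⟩
    (c ∸ l) * (c P′ l)               ∎
    where
    open ≡-Reasoning
    P′-peel : ∀ c l → c * (pred c P′ l) ≡ (c ∸ l) * (c P′ l)
    P′-peel c zero    = refl
    P′-peel c (suc l) = begin
      c * ((pred c ∸ l) * (pred c P′ l))   ≡⟨ x*[y*z]≡y*[x*z] c (pred c ∸ l) _ ⟩
      (pred c ∸ l) * (c * (pred c P′ l))   ≡⟨ cong₂ _*_ (trans (cong (_∸ l) (pred≡∸1 c)) (∸-+-assoc c 1 l)) (P′-peel c l) ⟩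
      (c ∸ suc l) * ((c ∸ l) * (c P′ l))   ∎
      where
      x*[y*z]≡y*[x*z] : ∀ x y z → x * (y * z) ≡ y * (x * z)
      x*[y*z]≡y*[x*z] = solve-∀
      pred≡∸1 : ∀ c → pred c ≡ c ∸ 1
      pred≡∸1 zero    = refl
      pred≡∸1 (suc c) = refl

  fallingFactorial-mono : ∀ {c c′} l → c ≤ c′ → fallingFactorial c l ≤ fallingFactorial c′ l
  fallingFactorial-mono zero    _    = ≤-refl
  fallingFactorial-mono (suc l) c≤c′ = *-mono-≤ c≤c′ (fallingFactorial-mono l (pred-mono-≤ c≤c′))

  P≤fallingFactorial : ∀ {A c} B → A ≤ c → A P B ≤ fallingFactorial c B
  P≤fallingFactorial {A} B A≤c with B ≤ᵇ A
  ... | true  = ≤-trans (≤-reflexive (sym (fallingFactorial≡P′ A B))) (fallingFactorial-mono B A≤c)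
  ... | false = z≤n

  pick : ∀ {n} (Q : Fin n → Bool) {c} → c ≤ count Q → Fin c → Fin n
  pick {zero}  Q {zero} c≤ ()
  pick {suc n} Q c≤ i with Q zero
  pick {suc n} Q {suc c} c≤ zero    | true  = zero
  pick {suc n} Q {suc c} c≤ (suc i) | true  = suc (pick (Q ∘ suc) (≤-pred c≤) i)
  pick {suc n} Q         c≤ i       | false = suc (pick (Q ∘ suc) c≤ i)

  pick-true : ∀ {n} (Q : Fin n → Bool) {c} (c≤ : c ≤ count Q) i → Q (pick Q c≤ i) ≡ true
  pick-true {zero}  Q {zero} c≤ ()
  pick-true {suc n} Q c≤ i with Q zero in eq
  pick-true {suc n} Q {suc c} c≤ zero    | true  = eq
  pick-true {suc n} Q {suc c} c≤ (suc i) | true  = pick-true (Q ∘ suc) (≤-pred c≤) i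
  pick-true {suc n} Q         c≤ i       | false = pick-true (Q ∘ suc) c≤ i

  pick-injective : ∀ {n} (Q : Fin n → Bool) {c} (c≤ : c ≤ count Q) {i j} → pick Q c≤ i ≡ pick Q c≤ j → i ≡ j
  pick-injective {zero}  Q {zero} c≤ {()}
  pick-injective {suc n} Q c≤ {i} {j} e with Q zero
  pick-injective {suc n} Q {suc c} c≤ {zero}  {zero}  e  | true = refl
  pick-injective {suc n} Q {suc c} c≤ {suc i} {suc j} e  | true =
    cong suc (pick-injective (Q ∘ suc) (≤-pred c≤) (Fin.suc-injective e))
  pick-injective {suc n} Q {suc c} c≤ {zero}  {suc j} () | true
  pick-injective {suc n} Q {suc c} c≤ {suc i} {zero}  () | true
  pick-injective {suc n} Q c≤ e | false = pick-injective (Q ∘ suc) c≤ (Fin.suc-injective e)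

  module _ {n : ℕ} (G : Graph n) where
    open Graph G
    open IsMatching

    freeNeighbours : Adj n → Fin n → ℕ
    freeNeighbours M h = count (λ w → adj h w ∧ free M w)

    Ready : Adj n → ℕ → Fin n × Fin n → Set
    Ready M c (h , h′) = M h h′ ≡ true × c ≤ freeNeighbours M h

    Apart : Fin n × Fin n → Fin n × Fin n → Set
    Apart (a , b) (h , _) = h ≢ a × h ≢ b

    module SwapStep {M : Adj n} (M-match : IsMatching G M) (c : ℕ) (a b : Fin n)
                    (ab : M a b ≡ true) (c≤ : c ≤ freeNeighbours M a) (j : Fin c) where
      freeNeighbour : Fin n → Bool
      freeNeighbour w = adj a w ∧ free M w

      target : Fin n
      target = pick freeNeighbour c≤ j

      a-target : adj a target ≡ true
      a-target = proj₁ (∧≡true {adj a target} (pick-true freeNeighbour c≤ j))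

      target-free : free M target ≡ true
      target-free = proj₂ (∧≡true {adj a target} (pick-true freeNeighbour c≤ j))

      open Swap G M-match a b target ab target-free a-target public

      freeNeighbours-drop : ∀ h → freeNeighbours M h ≤ suc (freeNeighbours M′ h)
      freeNeighbours-drop h = ≤-trans (sum-mono-≤ per-vertex) (≤-reflexive (begin
        sum (λ w → Bool→ℕ (adj h w ∧ free M′ w) + Bool→ℕ (w == target)) ≡⟨ ∑-distrib-+ (λ w → Bool→ℕ (adj h w ∧ free M′ w)) _ ⟩
        freeNeighbours M′ h + count (_== target)                      ≡⟨ cong (freeNeighbours M′ h +_) (count-== target) ⟩
        freeNeighbours M′ h + 1                                       ≡⟨ +-comm _ 1 ⟩
        suc (freeNeighbours M′ h)                                     ∎))
        where
        open ≡-Reasoning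
        per-vertex : ∀ w → Bool→ℕ (adj h w ∧ free M w) ≤ Bool→ℕ (adj h w ∧ free M′ w) + Bool→ℕ (w == target)
        per-vertex w with w Fin.≟ target
        ... | yes refl rewrite ==-refl w = ≤-trans (Bool→ℕ≤1 _) (m≤n+m 1 _)
        ... | no w≢target with free M w in w-free
        ...   | false rewrite ∧-zeroʳ (adj h w) = z≤n
        ...   | true rewrite stays-free w w-free w≢target = m≤m+n _ _

      stays-ready : ∀ {hs} → All (Apart (a , b)) hs → All (Ready M c) hs → All (Ready M′ (pred c)) hs
      stays-ready []                        []                  = []
      stays-ready {(h , h′) ∷ _} ((h≢a , h≢b) ∷ aps) ((hh′ , c≤h) ∷ rs) =
        (keeps h h′ hh′ h≢a h≢b , pred-ready) ∷ stays-ready aps rs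
        where
        pred-ready : pred c ≤ freeNeighbours M′ h
        pred-ready = ≤-trans (pred-mono-≤ c≤h) (pred-mono-≤ (freeNeighbours-drop h))

    -- Each step swaps the matching edge at the next head to one of c free neighbours; that uses up one
    -- free vertex, so every later head keeps at least c - 1 free neighbours.
    build : (M : Adj n) → IsMatching G M → (c : ℕ) → (hs : List (Fin n × Fin n)) →
            All (Ready M c) hs → AllPairs Apart hs → Fin (fallingFactorial c (length hs)) → Adj n
    build-with : (M : Adj n) → IsMatching G M → (c : ℕ) → (a b : Fin n) → (hs : List (Fin n × Fin n)) →
                 All (Ready M c) ((a , b) ∷ hs) → AllPairs Apart ((a , b) ∷ hs) →
                 Fin c → Fin (fallingFactorial (pred c) (length hs)) → Adj n
    build M _ c [] _ _ _ = M
    build M M-match c ((a , b) ∷ hs) rs aps i =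
      build-with M M-match c a b hs rs aps (proj₁ (remQuot {c} _ i)) (proj₂ (remQuot {c} _ i))
    build-with M M-match c a b hs ((ab , c≤) ∷ rs) (ap ∷ aps) j =
      build (S.M′ j) (S.isMatching j) (pred c) hs (S.stays-ready j ap rs) aps
      where module S j = SwapStep M-match c a b ab c≤ j

    build-isMatching : ∀ M M-match c hs rs aps i → IsMatching G (build M M-match c hs rs aps i)
    build-isMatching M M-match c [] _ _ _ = M-match
    build-isMatching M M-match c ((a , b) ∷ hs) ((ab , c≤) ∷ rs) (ap ∷ aps) i = build-isMatching _ _ (pred c) hs _ aps _

    build-size : ∀ M M-match c hs rs aps i → matchingSize (build M M-match c hs rs aps i) ≡ matchingSize M
    build-size M M-match c [] _ _ _ = refl
    build-size M M-match c ((a , b) ∷ hs) ((ab , c≤) ∷ rs) (ap ∷ aps) i =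
      trans (build-size _ _ (pred c) hs _ aps _) (SwapStep.size-M′ M-match c a b ab c≤ (proj₁ (remQuot {c} _ i)))

    build-keeps : ∀ M M-match c hs rs aps i x y → M x y ≡ true → All (Apart (x , y)) hs →
                  build M M-match c hs rs aps i x y ≡ true
    build-keeps M M-match c [] _ _ _ x y xy _ = xy
    build-keeps M M-match c ((a , b) ∷ hs) ((ab , c≤) ∷ rs) (ap ∷ aps) i x y xy ((a≢x , a≢y) ∷ xy-apart) =
      build-keeps _ _ (pred c) hs _ aps _ x y
        (SwapStep.keeps M-match c a b ab c≤ (proj₁ (remQuot {c} _ i)) x y xy (a≢x ∘ sym) x≢b) xy-apart
      where
      x≢b : x ≢ b
      x≢b refl = a≢y (atMostOne M-match b a y (trans (symmetric M-match b a) ab) xy)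

    apart-from-free : ∀ {M c a b u} hs → free M u ≡ true → All (Apart (a , b)) hs → All (Ready M c) hs →
                      All (Apart (a , u)) hs
    apart-from-free []                  _      []                []              = []
    apart-from-free {M} {u = u} ((h , h′) ∷ hs) u-free ((h≢a , _) ∷ aps) ((hh′ , _) ∷ rs) =
      (h≢a , free-≢ M u h u-free (edge⇒not-free M h h′ hh′) ∘ sym) ∷ apart-from-free hs u-free aps rs

    build-injective : ∀ M M-match c hs rs aps i i′ →
                      (∀ x y → build M M-match c hs rs aps i x y ≡ build M M-match c hs rs aps i′ x y) → i ≡ i′
    build-with-injective : ∀ M M-match c a b hs rs aps j j′ i i′ →
                           (∀ x y → build-with M M-match c a b hs rs aps j i x y ≡ build-with M M-match c a b hs rs aps j′ i′ x y) →
                           j ≡ j′ × i ≡ i′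
    build-injective M M-match c [] _ _ zero zero _ = refl
    build-injective M M-match c ((a , b) ∷ hs) rs aps i i′ same =
      let j≡j′ , i≡i′ = build-with-injective M M-match c a b hs rs aps _ _ _ _ same
      in trans (sym (Fin.combine-remQuot {c} _ i)) (trans (cong₂ Fin.combine j≡j′ i≡i′) (Fin.combine-remQuot {c} _ i′))
    build-with-injective M M-match c a b hs ((ab , c≤) ∷ rs) (ap ∷ aps) j j′ i i′ same = j≡j′ , rest j≡j′ i′ same
      where
      module S j = SwapStep M-match c a b ab c≤ j
      has-a-target : ∀ j i → build-with M M-match c a b hs ((ab , c≤) ∷ rs) (ap ∷ aps) j i a (S.target j) ≡ true
      has-a-target j i = build-keeps (S.M′ j) (S.isMatching j) (pred c) hs _ aps i a (S.target j) (S.has-ac j)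
                           (apart-from-free hs (S.target-free j) ap rs)
      j≡j′ : j ≡ j′
      j≡j′ = pick-injective (S.freeNeighbour j) c≤
        (atMostOne (build-isMatching (S.M′ j) (S.isMatching j) (pred c) hs _ aps i) a (S.target j) (S.target j′)
                   (has-a-target j i) (trans (same a (S.target j′)) (has-a-target j′ i′)))
      rest : ∀ {j′} → j ≡ j′ → ∀ i′ →
             (∀ x y → build-with M M-match c a b hs ((ab , c≤) ∷ rs) (ap ∷ aps) j i x y
                    ≡ build-with M M-match c a b hs ((ab , c≤) ∷ rs) (ap ∷ aps) j′ i′ x y) → i ≡ i′
      rest refl i′ same′ = build-injective (S.M′ j) (S.isMatching j) (pred c) hs _ aps i i′ same′

  -- Structure of a maximum matching

  module MaximumMatching {n k : ℕ} (G : Graph n) (hm : HasMatchingNumber G k) where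
    open Graph G renaming (symmetric to adj-sym)
    open HasMatchingNumber hm renaming (witness to M; isMatch to M-match; sizeEq to size-M)
    open IsMatching M-match

    free-independent : ∀ u w → free M u ≡ true → free M w ≡ true → adj u w ≡ false
    free-independent u w u-free w-free with adj u w in uw
    ... | false = refl
    ... | true  = ⊥-elim (1+n≰n (subst (_≤ k) (trans size-M⁺ (cong suc size-M)) (maximal _ isMatching)))
      where open Augment G M-match u w u-free w-free uw

    no-augmenting-3-path : ∀ a b x y → M a b ≡ true → adj a x ≡ true → free M x ≡ true →
                           adj b y ≡ true → free M y ≡ true → x ≢ y → ⊥
    no-augmenting-3-path a b x y ab ax x-free by y-free x≢y =
      1+n≰n (subst (_≤ k) (trans A.size-M⁺ (cong suc (trans S.size-M′ size-M))) (maximal _ A.isMatching))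
      where
      module S = Swap G M-match a b x ab x-free ax
      module A = Augment G S.isMatching b y S.b-free (S.stays-free y y-free (x≢y ∘ sym)) by

    covered : Fin n → Bool
    covered v = not (free M v)

    count-covered : count covered ≡ 2 * k
    count-covered = begin
      count covered            ≡⟨ sum-cong-≗ (matching-deg≡covered G M-match) ⟩
      sum (deg M)              ≡⟨ matching-size-double G M-match ⟩
      2 * matchingSize M       ≡⟨ cong (2 *_) size-M ⟩
      2 * k                    ∎
      where open ≡-Reasoning

    count-free+2k≡n : count (free M) + 2 * k ≡ n
    count-free+2k≡n = begin
      count (free M) + 2 * k              ≡⟨ cong (count (free M) +_) count-covered ⟨
      count (free M) + count covered      ≡⟨ ∑-distrib-+ (Bool→ℕ ∘ free M) _ ⟨
      sum (λ v → Bool→ℕ (free M v) + Bool→ℕ (covered v)) ≡⟨ sum-cong-≗ (one ∘ free M) ⟩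
      sum {n} (λ _ → 1)                   ≡⟨ sum-ones n ⟩
      n                                   ∎
      where
      open ≡-Reasoning
      one : ∀ b → Bool→ℕ b + Bool→ℕ (not b) ≡ 1
      one true  = refl
      one false = refl
      sum-ones : ∀ m → sum {m} (λ _ → 1) ≡ m
      sum-ones zero    = refl
      sum-ones (suc m) = cong suc (sum-ones m)

    freeDeg : Fin n → ℕ
    freeDeg v = count (λ w → adj v w ∧ free M w)

    coveredDeg : Fin n → ℕ
    coveredDeg v = count (λ w → adj v w ∧ covered w)

    deg≡coveredDeg+freeDeg : ∀ v → deg adj v ≡ coveredDeg v + freeDeg v
    deg≡coveredDeg+freeDeg v = trans (sum-cong-≗ split) (∑-distrib-+ (λ w → Bool→ℕ (adj v w ∧ covered w)) _)
      where
      split : ∀ w → Bool→ℕ (adj v w) ≡ Bool→ℕ (adj v w ∧ covered w) + Bool→ℕ (adj v w ∧ free M w)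
      split w with adj v w | free M w
      ... | true  | true  = refl
      ... | true  | false = refl
      ... | false | _     = refl

    freeDeg≤#free : ∀ v → freeDeg v ≤ count (free M)
    freeDeg≤#free v = sum-mono-≤ λ w → Bool→ℕ-mono (proj₂ ∘ ∧≡true {adj v w})

    free⇒freeDeg≡0 : ∀ v → free M v ≡ true → freeDeg v ≡ 0
    free⇒freeDeg≡0 v v-free = count-false _ λ w → no-free-neighbour w (free M w) refl
      where
      no-free-neighbour : ∀ w b → free M w ≡ b → (adj v w ∧ b) ≡ false
      no-free-neighbour w false _ = ∧-zeroʳ (adj v w)
      no-free-neighbour w true w-free rewrite free-independent v w v-free w-free = refl

    coveredDeg<2k : ∀ v → covered v ≡ true → coveredDeg v < 2 * k
    coveredDeg<2k v v-covered = subst (coveredDeg v <_) count-covered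
      (sum-mono-< v (λ w → Bool→ℕ-mono (proj₂ ∘ ∧≡true {adj v w})) no-loop)
      where
      no-loop : Bool→ℕ (adj v v ∧ covered v) < Bool→ℕ (covered v)
      no-loop rewrite irreflexive v | v-covered = s≤s z≤n

    crossEdges : ℕ
    crossEdges = sum (λ v → Bool→ℕ (covered v) * freeDeg v)

    crossEdges-from-free : sum (λ v → Bool→ℕ (free M v) * coveredDeg v) ≡ crossEdges
    crossEdges-from-free = begin
        sum (λ v → Bool→ℕ (free M v) * coveredDeg v)
      ≡⟨ sum-cong-≗ (λ v → sum-*ˡ (Bool→ℕ (free M v)) (λ w → Bool→ℕ (adj v w ∧ covered w))) ⟨
        sum (λ v → sum (λ w → Bool→ℕ (free M v) * Bool→ℕ (adj v w ∧ covered w)))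
      ≡⟨ ∑-comm (λ v w → Bool→ℕ (free M v) * Bool→ℕ (adj v w ∧ covered w)) ⟩
        sum (λ w → sum (λ v → Bool→ℕ (free M v) * Bool→ℕ (adj v w ∧ covered w)))
      ≡⟨ sum-cong-≗ (λ w → sum-cong-≗ (λ v → transpose v w)) ⟩
        sum (λ w → sum (λ v → Bool→ℕ (covered w) * Bool→ℕ (adj w v ∧ free M v)))
      ≡⟨ sum-cong-≗ (λ w → sum-*ˡ (Bool→ℕ (covered w)) (λ v → Bool→ℕ (adj w v ∧ free M v))) ⟩
        crossEdges
      ∎
      where
      open ≡-Reasoning
      transpose : ∀ v w → Bool→ℕ (free M v) * Bool→ℕ (adj v w ∧ covered w)
                        ≡ Bool→ℕ (covered w) * Bool→ℕ (adj w v ∧ free M v)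
      transpose v w rewrite adj-sym v w with free M v | free M w | adj w v
      ... | true  | true  | true  = refl
      ... | true  | true  | false = refl
      ... | true  | false | true  = refl
      ... | true  | false | false = refl
      ... | false | true  | _     = refl
      ... | false | false | true  = refl
      ... | false | false | false = refl

    size≤crossEdges : 2 * size G + 2 * k ≤ 2 * crossEdges + 2 * k * (2 * k)
    size≤crossEdges = begin
        2 * size G + 2 * k
      ≡⟨ cong (_+ 2 * k) (handshake adj adj-sym irreflexive) ⟨
        sum (deg adj) + 2 * k
      ≡⟨ cong (_+ 2 * k) (sum-cong-≗ deg-split) ⟩
        sum (λ v → Bool→ℕ (free M v) * coveredDeg v + (Bool→ℕ (covered v) * coveredDeg v + Bool→ℕ (covered v) * freeDeg v)) + 2 * k
      ≡⟨ cong (_+ 2 * k) (trans (∑-distrib-+ (λ v → Bool→ℕ (free M v) * coveredDeg v) _)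
                                (cong₂ _+_ crossEdges-from-free (∑-distrib-+ (λ v → Bool→ℕ (covered v) * coveredDeg v) _))) ⟩
        crossEdges + (inner + crossEdges) + 2 * k
      ≡⟨ regroup crossEdges inner (2 * k) ⟩
        2 * crossEdges + (inner + 2 * k)
      ≡⟨ cong (λ c → 2 * crossEdges + (inner + c)) count-covered ⟨
        2 * crossEdges + (inner + count covered)
      ≡⟨ cong (2 * crossEdges +_) (∑-distrib-+ (λ v → Bool→ℕ (covered v) * coveredDeg v) _) ⟨
        2 * crossEdges + sum (λ v → Bool→ℕ (covered v) * coveredDeg v + Bool→ℕ (covered v))
      ≤⟨ +-monoʳ-≤ (2 * crossEdges) (sum-mono-≤ (λ v → per-vertex v (covered v) refl)) ⟩
        2 * crossEdges + sum (λ v → 2 * k * Bool→ℕ (covered v))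
      ≡⟨ cong (2 * crossEdges +_) (trans (sum-*ˡ (2 * k) (Bool→ℕ ∘ covered)) (cong (2 * k *_) count-covered)) ⟩
        2 * crossEdges + 2 * k * (2 * k)
      ∎
      where
      open ≤-Reasoning
      inner : ℕ
      inner = sum (λ v → Bool→ℕ (covered v) * coveredDeg v)
      regroup : ∀ x y z → x + (y + x) + z ≡ 2 * x + (y + z)
      regroup = solve-∀
      deg-split : ∀ v → deg adj v ≡ Bool→ℕ (free M v) * coveredDeg v
                                   + (Bool→ℕ (covered v) * coveredDeg v + Bool→ℕ (covered v) * freeDeg v)
      deg-split v with free M v in v-free
      ... | true  = begin-equality
          deg adj v                ≡⟨ deg≡coveredDeg+freeDeg v ⟩
          coveredDeg v + freeDeg v ≡⟨ cong (coveredDeg v +_) (free⇒freeDeg≡0 v v-free) ⟩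
          coveredDeg v + 0         ≡⟨ cong (_+ 0) (+-identityʳ (coveredDeg v)) ⟨
          coveredDeg v + 0 + 0     ∎
      ... | false = trans (deg≡coveredDeg+freeDeg v) (sym (cong₂ _+_ (+-identityʳ (coveredDeg v)) (+-identityʳ (freeDeg v))))
      per-vertex : ∀ v b → covered v ≡ b → Bool→ℕ b * coveredDeg v + Bool→ℕ b ≤ 2 * k * Bool→ℕ b
      per-vertex v false _ = z≤n
      per-vertex v true v-covered rewrite +-identityʳ (coveredDeg v) | *-identityʳ (2 * k) =
        subst (_≤ 2 * k) (+-comm 1 (coveredDeg v)) (coveredDeg<2k v v-covered)

    partner : Fin n → Fin n
    partner v with search (M v)
    ... | inj₁ (w , _) = w
    ... | inj₂ _       = v

    partner-unique : ∀ v w → M v w ≡ true → partner v ≡ w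
    partner-unique v w vw with search (M v)
    ... | inj₁ (w′ , vw′) = atMostOne v w′ w vw′ vw
    ... | inj₂ none with () ← trans (sym vw) (none w)

    partner-free : ∀ v → free M v ≡ true → partner v ≡ v
    partner-free v v-free with search (M v)
    ... | inj₁ (w , vw) with () ← trans (sym vw) (free⇒no-edge M v v-free w)
    ... | inj₂ _ = refl

    partner-edge : ∀ v → covered v ≡ true → M v (partner v) ≡ true
    partner-edge v v-covered with search (M v)
    ... | inj₁ (_ , vw) = vw
    ... | inj₂ none with () ← trans (sym v-covered) (cong not (free-intro M v none))

    partner-involutive : ∀ v → partner (partner v) ≡ v
    partner-involutive v with free M v in v-free
    ... | true  rewrite partner-free v v-free = partner-free v v-free
    ... | false = partner-unique (partner v) v (trans (symmetric (partner v) v) (partner-edge v (cong not v-free)))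

    covered-partner : ∀ v → covered (partner v) ≡ covered v
    covered-partner v with free M v in v-free
    ... | true  rewrite partner-free v v-free | v-free = refl
    ... | false = cong not (edge⇒not-free M (partner v) v
                    (trans (symmetric (partner v) v) (partner-edge v (cong not v-free))))

    freeDeg-exclusive : ∀ v → covered v ≡ true → 2 ≤ freeDeg v → 1 ≤ freeDeg (partner v) → ⊥
    freeDeg-exclusive v v-covered 2≤fd 1≤fd′ =
      let y , y-adj-free       = count-witness _ 1≤fd′
          x , x-adj-free , x≢y = count-witness-≢ _ 2≤fd y
          vx , x-free = ∧≡true {adj v x} x-adj-free
          py , y-free = ∧≡true {adj (partner v) y} y-adj-free
      in no-augmenting-3-path v (partner v) x y (partner-edge v v-covered) vx x-free py y-free x≢y

    module Heavy (t : ℕ) (2≤t : 2 ≤ t) where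
      heavy : Fin n → Bool
      heavy v = covered v ∧ (suc t ≤ᵇ freeDeg v)

      heavy⇒covered : ∀ v → heavy v ≡ true → covered v ≡ true
      heavy⇒covered v h = proj₁ (∧≡true {covered v} h)

      heavy⇒freeDeg : ∀ v → heavy v ≡ true → t < freeDeg v
      heavy⇒freeDeg v h = ≤ᵇ⇒≤ (suc t) (freeDeg v) (Equivalence.from T-≡ (proj₂ (∧≡true {covered v} h)))

      light⇒freeDeg≤t : ∀ v → covered v ≡ true → heavy v ≡ false → freeDeg v ≤ t
      light⇒freeDeg≤t v v-covered light with freeDeg v ≤? t
      ... | yes fd≤t = fd≤t
      ... | no fd≰t rewrite v-covered | ≤⇒≤ᵇ≡true (≰⇒> fd≰t) with () ← light

      heavy⇒partner-freeDeg≡0 : ∀ v → heavy v ≡ true → freeDeg (partner v) ≡ 0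
      heavy⇒partner-freeDeg≡0 v h with freeDeg (partner v) in e
      ... | zero  = refl
      ... | suc _ = ⊥-elim (freeDeg-exclusive v (heavy⇒covered v h)
                              (≤-trans 2≤t (<⇒≤ (heavy⇒freeDeg v h))) (subst (1 ≤_) (sym e) (s≤s z≤n)))

      freeDeg≤1 : ∀ v → covered v ≡ true → 1 ≤ freeDeg (partner v) → freeDeg v ≤ 1
      freeDeg≤1 v v-covered 1≤fd′ with freeDeg v ≤? 1
      ... | yes fd≤1 = fd≤1
      ... | no fd≰1  = ⊥-elim (freeDeg-exclusive v v-covered (≰⇒> fd≰1) 1≤fd′)

      heavy⇒partner-light : ∀ v → heavy v ≡ true → heavy (partner v) ≡ false
      heavy⇒partner-light v h with heavy (partner v) in h′
      ... | false = refl
      ... | true with () ← ≤-trans (heavy⇒freeDeg (partner v) h′) (≤-reflexive (heavy⇒partner-freeDeg≡0 v h))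

      #heavy : ℕ
      #heavy = count heavy

      lightPair : Fin n → Bool
      lightPair v = covered v ∧ (not (heavy v) ∧ not (heavy (partner v)))

      count-covered≡ : 2 * k ≡ count lightPair + 2 * #heavy
      count-covered≡ = begin
        2 * k                                       ≡⟨ count-covered ⟨
        count covered                               ≡⟨ sum-cong-≗ classify ⟩
        sum (λ v → Bool→ℕ (lightPair v) + (Bool→ℕ (heavy v) + Bool→ℕ (heavy (partner v))))
                                                    ≡⟨ ∑-distrib-+ (Bool→ℕ ∘ lightPair) _ ⟩
        count lightPair + sum (λ v → Bool→ℕ (heavy v) + Bool→ℕ (heavy (partner v)))
                                                    ≡⟨ cong (count lightPair +_) (∑-distrib-+ (Bool→ℕ ∘ heavy) _) ⟩
        count lightPair + (#heavy + count (heavy ∘ partner))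
                                                    ≡⟨ cong (λ h → count lightPair + (#heavy + h))
                                                            (sum-involution partner partner-involutive (Bool→ℕ ∘ heavy)) ⟩
        count lightPair + (#heavy + #heavy)         ≡⟨ cong (count lightPair +_) (cong (#heavy +_) (+-identityʳ #heavy)) ⟨
        count lightPair + 2 * #heavy                ∎
        where
        open ≡-Reasoning
        classify : ∀ v → Bool→ℕ (covered v) ≡ Bool→ℕ (lightPair v) + (Bool→ℕ (heavy v) + Bool→ℕ (heavy (partner v)))
        classify v = split (covered v) (heavy v) (heavy (partner v)) (heavy⇒covered v)
                       (λ h′ → trans (sym (covered-partner v)) (heavy⇒covered (partner v) h′)) (heavy⇒partner-light v)
          where
          split : ∀ c h h′ → (h ≡ true → c ≡ true) → (h′ ≡ true → c ≡ true) → (h ≡ true → h′ ≡ false) →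
                  Bool→ℕ c ≡ Bool→ℕ (c ∧ (not h ∧ not h′)) + (Bool→ℕ h + Bool→ℕ h′)
          split true  true  true  _ _ excl with () ← excl refl
          split true  true  false _ _ _ = refl
          split true  false true  _ _ _ = refl
          split true  false false _ _ _ = refl
          split false true  _ c⇐h _ _ with () ← c⇐h refl
          split false false true _ c⇐h′ _ with () ← c⇐h′ refl
          split false false false _ _ _ = refl

      private
        two-small≤t : ∀ a b → a ≤ t → b ≤ t → (1 ≤ b → a ≤ 1) → (1 ≤ a → b ≤ 1) → a + b ≤ t
        two-small≤t zero    b       _   b≤t _ _ = b≤t
        two-small≤t (suc a) zero    a≤t _   _ _ = subst (_≤ t) (sym (+-identityʳ (suc a))) a≤t
        two-small≤t (suc a) (suc b) _   _   a≤1 b≤1 = ≤-trans (+-mono-≤ (a≤1 (s≤s z≤n)) (b≤1 (s≤s z≤n))) 2≤t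

        s≤s*[1+h] : ∀ s h r → s ≤ s * (1 + h) + r
        s≤s*[1+h] s h r = ≤-trans (m≤m*n s (1 + h)) (m≤m+n _ r)

        pair-bound : ∀ (c h h′ : Bool) (a b s : ℕ) → a ≤ s → b ≤ s →
                     (h ≡ true → b ≡ 0) → (h′ ≡ true → a ≡ 0) →
                     (c ≡ true → h ≡ false → a ≤ t) → (c ≡ true → h′ ≡ false → b ≤ t) →
                     (c ≡ true → 1 ≤ b → a ≤ 1) → (c ≡ true → 1 ≤ a → b ≤ 1) →
                     Bool→ℕ c * (a + b) ≤ s * (Bool→ℕ h + Bool→ℕ h′) + t * Bool→ℕ (c ∧ (not h ∧ not h′))
        pair-bound false h h′ a b s _ _ _ _ _ _ _ _ = z≤n
        pair-bound true true h′ a b s a≤s _ b≡0 _ _ _ _ _ rewrite b≡0 refl | +-identityʳ a | +-identityʳ a =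
          ≤-trans a≤s (s≤s*[1+h] s (Bool→ℕ h′) _)
        pair-bound true false true a b s _ b≤s _ a≡0 _ _ _ _ rewrite a≡0 refl | +-identityʳ b =
          ≤-trans b≤s (≤-trans (s≤s*[1+h] s 0 (t * 0)) (≤-reflexive (cong (λ m → s * m + t * 0) (+-comm 1 0))))
        pair-bound true false false a b s _ _ _ _ a≤t b≤t a≤1 b≤1 rewrite +-identityʳ (a + b) | *-identityʳ t | *-zeroʳ s =
          two-small≤t a b (a≤t refl refl) (b≤t refl refl) (a≤1 refl) (b≤1 refl)

      crossEdges≤ : 2 * crossEdges ≤ count (free M) * (2 * #heavy) + t * count lightPair
      crossEdges≤ = begin
          2 * crossEdges
        ≡⟨ cong (crossEdges +_) (trans (+-identityʳ crossEdges) (sym crossEdges-via-partner)) ⟩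
          crossEdges + sum (λ v → Bool→ℕ (covered v) * freeDeg (partner v))
        ≡⟨ ∑-distrib-+ (λ v → Bool→ℕ (covered v) * freeDeg v) _ ⟨
          sum (λ v → Bool→ℕ (covered v) * freeDeg v + Bool→ℕ (covered v) * freeDeg (partner v))
        ≡⟨ sum-cong-≗ (λ v → *-distribˡ-+ (Bool→ℕ (covered v)) (freeDeg v) (freeDeg (partner v))) ⟨
          sum (λ v → Bool→ℕ (covered v) * (freeDeg v + freeDeg (partner v)))
        ≤⟨ sum-mono-≤ per-pair ⟩
          sum (λ v → #free * (Bool→ℕ (heavy v) + Bool→ℕ (heavy (partner v))) + t * Bool→ℕ (lightPair v))
        ≡⟨ ∑-distrib-+ (λ v → #free * (Bool→ℕ (heavy v) + Bool→ℕ (heavy (partner v)))) _ ⟩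
          sum (λ v → #free * (Bool→ℕ (heavy v) + Bool→ℕ (heavy (partner v)))) + sum (λ v → t * Bool→ℕ (lightPair v))
        ≡⟨ cong₂ _+_ (trans (sum-*ˡ #free (λ v → Bool→ℕ (heavy v) + Bool→ℕ (heavy (partner v)))) (cong (#free *_) heavy-twice)) (sum-*ˡ t (Bool→ℕ ∘ lightPair)) ⟩
          #free * (2 * #heavy) + t * count lightPair
        ∎
        where
        open ≤-Reasoning
        #free : ℕ
        #free = count (free M)
        crossEdges-via-partner : sum (λ v → Bool→ℕ (covered v) * freeDeg (partner v)) ≡ crossEdges
        crossEdges-via-partner = trans
          (sum-cong-≗ (λ v → cong (_* freeDeg (partner v)) (cong Bool→ℕ (sym (covered-partner v)))))
          (sum-involution partner partner-involutive (λ v → Bool→ℕ (covered v) * freeDeg v))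
        heavy-twice : sum (λ v → Bool→ℕ (heavy v) + Bool→ℕ (heavy (partner v))) ≡ 2 * #heavy
        heavy-twice = trans (∑-distrib-+ (Bool→ℕ ∘ heavy) _)
          (cong (#heavy +_) (trans (sum-involution partner partner-involutive (Bool→ℕ ∘ heavy)) (sym (+-identityʳ #heavy))))
        per-pair : ∀ v → Bool→ℕ (covered v) * (freeDeg v + freeDeg (partner v))
                         ≤ #free * (Bool→ℕ (heavy v) + Bool→ℕ (heavy (partner v))) + t * Bool→ℕ (lightPair v)
        per-pair v = pair-bound (covered v) (heavy v) (heavy (partner v)) (freeDeg v) (freeDeg (partner v)) #free
          (freeDeg≤#free v) (freeDeg≤#free (partner v))
          (heavy⇒partner-freeDeg≡0 v)
          (λ h′ → subst (λ w → freeDeg w ≡ 0) (partner-involutive v) (heavy⇒partner-freeDeg≡0 (partner v) h′))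
          (light⇒freeDeg≤t v)
          (λ v-covered → light⇒freeDeg≤t (partner v) (trans (covered-partner v) v-covered))
          (freeDeg≤1 v)
          (λ v-covered 1≤fd → freeDeg≤1 (partner v) (trans (covered-partner v) v-covered)
                                 (subst (λ w → 1 ≤ freeDeg w) (sym (partner-involutive v)) 1≤fd))

      size-bound : 2 * size G + 2 * k ≤ (n ∸ 2 * k) * (2 * #heavy) + t * count lightPair + 2 * k * (2 * k)
      size-bound = begin
        2 * size G + 2 * k                                          ≤⟨ size≤crossEdges ⟩
        2 * crossEdges + 2 * k * (2 * k)                            ≤⟨ +-monoˡ-≤ _ crossEdges≤ ⟩
        count (free M) * (2 * #heavy) + t * count lightPair + 2 * k * (2 * k)
          ≡⟨ cong (λ s → s * (2 * #heavy) + t * count lightPair + 2 * k * (2 * k)) #free≡n∸2k ⟩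
        (n ∸ 2 * k) * (2 * #heavy) + t * count lightPair + 2 * k * (2 * k) ∎
        where
        open ≤-Reasoning
        #free≡n∸2k : count (free M) ≡ n ∸ 2 * k
        #free≡n∸2k = trans (sym (m+n∸n≡m _ (2 * k))) (cong (_∸ 2 * k) count-free+2k≡n)

      module _ (B : ℕ) (B≤#heavy : B ≤ #heavy) where
        heads : List (Fin n × Fin n)
        heads = tabulate (λ i → let h = pick heavy B≤#heavy i in h , partner h)

        heads-ready : All (Ready G M (suc t)) heads
        heads-ready = All.tabulate⁺ λ i → let h-heavy = pick-true heavy B≤#heavy i in
          partner-edge _ (heavy⇒covered _ h-heavy) , heavy⇒freeDeg _ h-heavy

        heads-apart : AllPairs (Apart G) heads
        heads-apart = AllPairs.tabulate⁺ λ {i} {j} i≢j →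
            i≢j ∘ pick-injective heavy B≤#heavy ∘ sym
          , λ e → heavy-not-partner (pick heavy B≤#heavy i) (pick heavy B≤#heavy j)
                    (pick-true heavy B≤#heavy i) (pick-true heavy B≤#heavy j) (sym e)
          where
          heavy-not-partner : ∀ v w → heavy v ≡ true → heavy w ≡ true → partner v ≢ w
          heavy-not-partner v w hv hw refl with () ← trans (sym hw) (heavy⇒partner-light v hv)

        swapped : Fin (fallingFactorial (suc t) (length heads)) → Adj n
        swapped = build G M M-match (suc t) heads heads-ready heads-apart

        swapped-maximum : ∀ i → IsMaximumMatching G (swapped i)
        swapped-maximum i = record
          { isMatch = build-isMatching G M M-match (suc t) heads heads-ready heads-apart i
          ; maximum = λ M′ M′-match → ≤-trans (maximal M′ M′-match)
              (≤-reflexive (sym (trans (build-size G M M-match (suc t) heads heads-ready heads-apart i) size-M)))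
          }

        swapped-injective : ∀ i j → (∀ u v → swapped i u v ≡ swapped j u v) → i ≡ j
        swapped-injective = build-injective G M M-match (suc t) heads heads-ready heads-apart

        length-heads : length heads ≡ B
        length-heads = length-tabulate _

  many-maximum-matchings : ∀ {n k} (G : Graph n) → HasMatchingNumber G k → (A B : ℕ) →
    (∀ H C → C + 2 * H ≡ 2 * k → H < B →
       (n ∸ 2 * k) * (2 * H) + (A + 2) * C + 2 * k * (2 * k) < 2 * size G + 2 * k) →
    Σ (Fin (A P B) → Adj n) λ f → (∀ i → IsMaximumMatching G (f i)) × (∀ i j → (∀ u v → f i u v ≡ f j u v) → i ≡ j)
  many-maximum-matchings G hm A B too-many-edges =
      (λ i → swapped B B≤#heavy (embed i))
    , (λ i → swapped-maximum B B≤#heavy (embed i))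
    , λ i j same → Fin.inject≤-injective A-P-B≤ A-P-B≤ i j (swapped-injective B B≤#heavy _ _ same)
    where
    open MaximumMatching G hm
    open Heavy (A + 2) (m≤n+m 2 A)
    B≤#heavy : B ≤ #heavy
    B≤#heavy with B ≤? #heavy
    ... | yes B≤H = B≤H
    ... | no B≰H  = ⊥-elim (<⇒≱ (too-many-edges #heavy (count lightPair) (sym count-covered≡) (≰⇒> B≰H)) size-bound)
    A-P-B≤ : A P B ≤ fallingFactorial (suc (A + 2)) (length (heads B B≤#heavy))
    A-P-B≤ = subst (λ l → A P B ≤ fallingFactorial (suc (A + 2)) l) (sym (length-heads B B≤#heavy))
               (P≤fallingFactorial B (≤-trans (m≤m+n A 2) (n≤1+n _)))
    embed : Fin (A P B) → Fin (fallingFactorial (suc (A + 2)) (length (heads B B≤#heavy)))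
    embed i = Fin.inject≤ i A-P-B≤


module Arithmetic where

  open import Data.Empty using (⊥-elim)
  open import Data.Integer as ℤ using (+_; -[1+_])
  import Data.Integer.Properties as ℤ
  import Data.Integer.DivMod as ℤ
  open import Data.Integer.Tactic.RingSolver using (solve-∀)
  open import Data.Product using (∃; _×_; _,_)
  open import Data.Nat as ℕ using (ℕ; zero; suc)
  import Data.Nat.Properties as ℕ
  import Data.Nat.Coprimality as Coprime
  open import Data.Rational
  open import Data.Rational.Properties
  open import Data.Rational.Solver
  open import Data.Unit using (tt)
  open import Relation.Binary.PropositionalEquality
  open Data.Rational.Solver.+-*-Solver

  0≤q-p⇒p≤q : ∀ {p q} → 0ℚ ≤ q - p → p ≤ q
  0≤q-p⇒p≤q {p} {q} 0≤q-p = subst₂ _≤_ (+-identityˡ p) (solve 2 (λ p q → (q :- p) :+ p := q) refl p q) (+-monoˡ-≤ p 0≤q-p)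

  0<q-p⇒p<q : ∀ {p q} → 0ℚ < q - p → p < q
  0<q-p⇒p<q {p} {q} 0<q-p = subst₂ _<_ (+-identityˡ p) (solve 2 (λ p q → (q :- p) :+ p := q) refl p q) (+-monoˡ-< p 0<q-p)

  p≤q⇒0≤q-p : ∀ {p q} → p ≤ q → 0ℚ ≤ q - p
  p≤q⇒0≤q-p {p} {q} p≤q = subst (_≤ q - p) (+-inverseʳ p) (+-monoˡ-≤ (- p) p≤q)

  p<q⇒0<q-p : ∀ {p q} → p < q → 0ℚ < q - p
  p<q⇒0<q-p {p} {q} p<q = subst (_< q - p) (+-inverseʳ p) (+-monoˡ-< (- p) p<q)

  0≤+ : ∀ {p q} → 0ℚ ≤ p → 0ℚ ≤ q → 0ℚ ≤ p + q
  0≤+ 0≤p 0≤q = +-mono-≤ 0≤p 0≤q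

  0<+ : ∀ {p q} → 0ℚ < p → 0ℚ ≤ q → 0ℚ < p + q
  0<+ 0<p 0≤q = +-mono-<-≤ 0<p 0≤q

  0≤* : ∀ {p q} → 0ℚ ≤ p → 0ℚ ≤ q → 0ℚ ≤ p * q
  0≤* {p} {q} 0≤p 0≤q = nonNegative⁻¹ (p * q) {{nonNeg*nonNeg⇒nonNeg p {{nonNegative 0≤p}} q {{nonNegative 0≤q}}}}

  0<* : ∀ {p q} → 0ℚ < p → 0ℚ < q → 0ℚ < p * q
  0<* {p} {q} 0<p 0<q = positive⁻¹ (p * q) {{pos*pos⇒pos p {{positive 0<p}} q {{positive 0<q}}}}

  ℕ→ℚ-normal : ∀ n → ℕ→ℚ n ≡ mkℚ (+ n) 0 (Coprime.sym (Coprime.1-coprimeTo n))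
  ℕ→ℚ-normal n = normalize-coprime (Coprime.sym (Coprime.1-coprimeTo n))

  ℕ→ℚ-suc : ∀ n → ℕ→ℚ (suc n) ≡ ℕ→ℚ n + 1ℚ
  ℕ→ℚ-suc n rewrite ℕ→ℚ-normal n =
    /-cong (trans (cong +_ (ℕ.+-comm 1 n)) (sym (cong₂ ℤ._+_ (ℤ.*-identityʳ (+ n)) (ℤ.*-identityʳ (+ 1))))) refl

  ℕ→ℚ-+ : ∀ m n → ℕ→ℚ (m ℕ.+ n) ≡ ℕ→ℚ m + ℕ→ℚ n
  ℕ→ℚ-+ m zero    rewrite ℕ.+-identityʳ m = sym (+-identityʳ (ℕ→ℚ m))
  ℕ→ℚ-+ m (suc n) rewrite ℕ.+-suc m n | ℕ→ℚ-suc (m ℕ.+ n) | ℕ→ℚ-+ m n | ℕ→ℚ-suc n =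
    +-assoc (ℕ→ℚ m) (ℕ→ℚ n) 1ℚ

  ℕ→ℚ-* : ∀ m n → ℕ→ℚ (m ℕ.* n) ≡ ℕ→ℚ m * ℕ→ℚ n
  ℕ→ℚ-* m zero    rewrite ℕ.*-zeroʳ m = sym (*-zeroʳ (ℕ→ℚ m))
  ℕ→ℚ-* m (suc n) rewrite ℕ.*-suc m n | ℕ→ℚ-+ m (m ℕ.* n) | ℕ→ℚ-* m n | ℕ→ℚ-suc n =
    solve 2 (λ x y → x :+ x :* y := x :* (y :+ con 1ℚ)) refl (ℕ→ℚ m) (ℕ→ℚ n)

  ℕ→ℚ-∸ : ∀ m n → n ℕ.≤ m → ℕ→ℚ (m ℕ.∸ n) ≡ ℕ→ℚ m - ℕ→ℚ n
  ℕ→ℚ-∸ m n n≤m = begin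
    ℕ→ℚ (m ℕ.∸ n)                    ≡⟨ solve 2 (λ x y → x := (x :+ y) :- y) refl (ℕ→ℚ (m ℕ.∸ n)) (ℕ→ℚ n) ⟩
    (ℕ→ℚ (m ℕ.∸ n) + ℕ→ℚ n) - ℕ→ℚ n  ≡⟨ cong (_- ℕ→ℚ n) (ℕ→ℚ-+ (m ℕ.∸ n) n) ⟨
    ℕ→ℚ (m ℕ.∸ n ℕ.+ n) - ℕ→ℚ n      ≡⟨ cong (λ x → ℕ→ℚ x - ℕ→ℚ n) (ℕ.m∸n+n≡m n≤m) ⟩
    ℕ→ℚ m - ℕ→ℚ n                    ∎
    where open ≡-Reasoning

  ℕ→ℚ-nonNeg : ∀ n → 0ℚ ≤ ℕ→ℚ n
  ℕ→ℚ-nonNeg n rewrite ℕ→ℚ-normal n =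
    *≤* (subst₂ ℤ._≤_ (sym (ℤ.*-identityʳ (+ 0))) (sym (ℤ.*-identityʳ (+ n))) (ℤ.+≤+ ℕ.z≤n))

  ℕ→ℚ-mono-≤ : ∀ {m n} → m ℕ.≤ n → ℕ→ℚ m ≤ ℕ→ℚ n
  ℕ→ℚ-mono-≤ {m} {n} m≤n rewrite sym (ℕ.m+[n∸m]≡n m≤n) | ℕ→ℚ-+ m (n ℕ.∸ m) =
    subst (_≤ ℕ→ℚ m + ℕ→ℚ (n ℕ.∸ m)) (+-identityʳ (ℕ→ℚ m)) (+-monoʳ-≤ (ℕ→ℚ m) (ℕ→ℚ-nonNeg (n ℕ.∸ m)))

  ℕ→ℚ-mono-< : ∀ {m n} → m ℕ.< n → ℕ→ℚ m < ℕ→ℚ n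
  ℕ→ℚ-mono-< {m} {n} m<n rewrite ℕ→ℚ-normal m | ℕ→ℚ-normal n =
    *<* (subst₂ ℤ._<_ (sym (ℤ.*-identityʳ (+ m))) (sym (ℤ.*-identityʳ (+ n))) (ℤ.+<+ m<n))

  0<1 : 0ℚ < 1ℚ
  0<1 = ℕ→ℚ-mono-< {0} {1} (ℕ.s≤s ℕ.z≤n)

  ℕ→ℚ-cancel-≤ : ∀ {m n} → ℕ→ℚ m ≤ ℕ→ℚ n → m ℕ.≤ n
  ℕ→ℚ-cancel-≤ {m} {n} m≤n rewrite ℕ→ℚ-normal m | ℕ→ℚ-normal n with *≤* m*1≤n*1 ← m≤n =
    ℤ.drop‿+≤+ (subst₂ ℤ._≤_ (ℤ.*-identityʳ (+ m)) (ℤ.*-identityʳ (+ n)) m*1≤n*1)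

  ℕ→ℚ-cancel-< : ∀ {m n} → ℕ→ℚ m < ℕ→ℚ n → m ℕ.< n
  ℕ→ℚ-cancel-< {m} {n} m<n rewrite ℕ→ℚ-normal m | ℕ→ℚ-normal n with *<* m*1<n*1 ← m<n =
    ℤ.drop‿+<+ (subst₂ ℤ._<_ (ℤ.*-identityʳ (+ m)) (ℤ.*-identityʳ (+ n)) m*1<n*1)

  edge-excess-identity : ∀ e N K A H m →
    + 2 / 1 * m + + 2 / 1 * K
      - ((N - + 2 / 1 * K) * (+ 2 / 1 * H) + (A + + 2 / 1) * (+ 2 / 1 * K - + 2 / 1 * H) + + 2 / 1 * K * (+ 2 / 1 * K))
    ≡ + 2 / 1 * e * K * ((1ℚ - e) * N + 1ℚ - A)
      + ((+ 2 / 1 * m - (+ 2 / 1 * K * (N - K) + K * K - K - e * e * K * N * (+ 1 / 8)))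
      + + 2 / 1 * ((1ℚ - e) * K - H) * (N - + 2 / 1 * K - (A + + 2 / 1))
      + K * (+ 4 / 1 * ((1ℚ - e) * K) + + 10 / 1 * (K - + 16 / 1) + + 6 / 1 * (1ℚ - e) + + 155 / 1)
      + + 15 / 8 * K * (e * e * N - + 8 / 1 * K))
  edge-excess-identity = solve 6 (λ e N K A H m →
      con (+ 2 / 1) :* m :+ con (+ 2 / 1) :* K
      :- ((N :- con (+ 2 / 1) :* K) :* (con (+ 2 / 1) :* H) :+ (A :+ con (+ 2 / 1)) :* (con (+ 2 / 1) :* K :- con (+ 2 / 1) :* H)
          :+ con (+ 2 / 1) :* K :* (con (+ 2 / 1) :* K))
      := con (+ 2 / 1) :* e :* K :* ((con 1ℚ :- e) :* N :+ con 1ℚ :- A)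
         :+ ((con (+ 2 / 1) :* m :- (con (+ 2 / 1) :* K :* (N :- K) :+ K :* K :- K :- e :* e :* K :* N :* con (+ 1 / 8)))
         :+ con (+ 2 / 1) :* ((con 1ℚ :- e) :* K :- H) :* (N :- con (+ 2 / 1) :* K :- (A :+ con (+ 2 / 1)))
         :+ K :* (con (+ 4 / 1) :* ((con 1ℚ :- e) :* K) :+ con (+ 10 / 1) :* (K :- con (+ 16 / 1)) :+ con (+ 6 / 1) :* (con 1ℚ :- e) :+ con (+ 155 / 1))
         :+ con (+ 15 / 8) :* K :* (e :* e :* N :- con (+ 8 / 1) :* K)))
    refl

  -- In the theorem K = νN: sparse restates ν < hν ε and large restates 1 ≤ hδ ε ν · N.
  module Regime {e N K : ℚ} (0<e : 0ℚ < e) (e<1 : e < 1ℚ) (0≤N : 0ℚ ≤ N) (0≤K : 0ℚ ≤ K)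
                (sparse : + 8 / 1 * K ≤ e * e * N) (large : + 16 / 1 ≤ e * e * K) where

    private
      0≤e : 0ℚ ≤ e
      0≤e = <⇒≤ 0<e

      0≤1-e : 0ℚ ≤ 1ℚ - e
      0≤1-e = <⇒≤ (p<q⇒0<q-p e<1)

      0≤1-e² : 0ℚ ≤ (1ℚ - e) * (1ℚ + e)
      0≤1-e² = 0≤* 0≤1-e (0≤+ (ℕ→ℚ-nonNeg 1) 0≤e)

      0≤sparse : 0ℚ ≤ e * e * N - + 8 / 1 * K
      0≤sparse = p≤q⇒0≤q-p sparse

    16≤K : + 16 / 1 ≤ K
    16≤K = 0≤q-p⇒p≤q (subst (0ℚ ≤_) (sym identity) (0≤+ (0≤* 0≤1-e² 0≤K) (p≤q⇒0≤q-p large)))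
      where
      identity : K - + 16 / 1 ≡ (1ℚ - e) * (1ℚ + e) * K + (e * e * K - + 16 / 1)
      identity = solve 2 (λ e K → K :- con (+ 16 / 1) := (con 1ℚ :- e) :* (con 1ℚ :+ e) :* K :+ (e :* e :* K :- con (+ 16 / 1))) refl e K

    0<K : 0ℚ < K
    0<K = <-≤-trans (ℕ→ℚ-mono-< {0} {16} (ℕ.s≤s ℕ.z≤n)) 16≤K

    2K≤N : + 2 / 1 * K ≤ N
    2K≤N = 0≤q-p⇒p≤q (subst (0ℚ ≤_) (sym identity) (0≤+ (0≤+ (0≤* 0≤1-e² 0≤N) 0≤sparse) (0≤* (ℕ→ℚ-nonNeg 6) 0≤K)))
      where
      identity : N - + 2 / 1 * K ≡ (1ℚ - e) * (1ℚ + e) * N + (e * e * N - + 8 / 1 * K) + + 6 / 1 * K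
      identity = solve 3 (λ e N K → N :- con (+ 2 / 1) :* K
                          := (con 1ℚ :- e) :* (con 1ℚ :+ e) :* N :+ (e :* e :* N :- con (+ 8 / 1) :* K) :+ con (+ 6 / 1) :* K)
                         refl e N K

    5K+3≤2N : + 5 / 1 * K + + 3 / 1 ≤ + 2 / 1 * N
    5K+3≤2N = 0≤q-p⇒p≤q (subst (0ℚ ≤_) (sym identity)
      (0≤+ (0≤+ (0≤+ (0≤* (ℕ→ℚ-nonNeg 2) (0≤* 0≤1-e² 0≤N)) (0≤* (ℕ→ℚ-nonNeg 2) 0≤sparse))
                (0≤* (ℕ→ℚ-nonNeg 11) (p≤q⇒0≤q-p 16≤K))) (ℕ→ℚ-nonNeg 173)))
      where
      identity : + 2 / 1 * N - (+ 5 / 1 * K + + 3 / 1)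
               ≡ + 2 / 1 * ((1ℚ - e) * (1ℚ + e) * N) + + 2 / 1 * (e * e * N - + 8 / 1 * K) + + 11 / 1 * (K - + 16 / 1) + + 173 / 1
      identity = solve 3 (λ e N K → con (+ 2 / 1) :* N :- (con (+ 5 / 1) :* K :+ con (+ 3 / 1))
                          := con (+ 2 / 1) :* ((con 1ℚ :- e) :* (con 1ℚ :+ e) :* N) :+ con (+ 2 / 1) :* (e :* e :* N :- con (+ 8 / 1) :* K)
                             :+ con (+ 11 / 1) :* (K :- con (+ 16 / 1)) :+ con (+ 173 / 1))
                         refl e N K

    room-for-A : (1ℚ - e) * N + + 3 / 1 ≤ N - + 2 / 1 * K
    room-for-A = 0≤q-p⇒p≤q (subst (0ℚ ≤_) (sym identity)
      (0≤+ (0≤+ (0≤+ (0≤* 0≤e (0≤* 0≤1-e 0≤N)) 0≤sparse) (0≤* (ℕ→ℚ-nonNeg 6) (p≤q⇒0≤q-p 16≤K))) (ℕ→ℚ-nonNeg 93)))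
      where
      identity : N - + 2 / 1 * K - ((1ℚ - e) * N + + 3 / 1)
               ≡ e * ((1ℚ - e) * N) + (e * e * N - + 8 / 1 * K) + + 6 / 1 * (K - + 16 / 1) + + 93 / 1
      identity = solve 3 (λ e N K → N :- con (+ 2 / 1) :* K :- ((con 1ℚ :- e) :* N :+ con (+ 3 / 1))
                          := e :* ((con 1ℚ :- e) :* N) :+ (e :* e :* N :- con (+ 8 / 1) :* K)
                             :+ con (+ 6 / 1) :* (K :- con (+ 16 / 1)) :+ con (+ 93 / 1))
                         refl e N K

    0≤D : ∀ {A} → A < (1ℚ - e) * N + 1ℚ → 0ℚ ≤ N - + 2 / 1 * K - (A + + 2 / 1)
    0≤D {A} A< = subst (0ℚ ≤_) (sym split) (0≤+ (p≤q⇒0≤q-p room-for-A) (<⇒≤ (p<q⇒0<q-p A<)))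
      where
      split : N - + 2 / 1 * K - (A + + 2 / 1) ≡ (N - + 2 / 1 * K - ((1ℚ - e) * N + + 3 / 1)) + ((1ℚ - e) * N + 1ℚ - A)
      split = solve 4 (λ e N K A → N :- con (+ 2 / 1) :* K :- (A :+ con (+ 2 / 1))
                       := (N :- con (+ 2 / 1) :* K :- ((con 1ℚ :- e) :* N :+ con (+ 3 / 1))) :+ ((con 1ℚ :- e) :* N :+ con 1ℚ :- A))
                      refl e N K A

    -- Raising H to (1 - e)K and A + 2 to (1 - e)N + 3 leaves (15/8)e²KN - (4e + 1)K² - (6e - 1)K,
    -- which is nonnegative because 8K ≤ e²N and K ≥ 16.
    edge-excess : ∀ {A H m} → A < (1ℚ - e) * N + 1ℚ → H < (1ℚ - e) * K →
                  + 2 / 1 * K * (N - K) + K * K - K - e * e * K * N * (+ 1 / 8) ≤ + 2 / 1 * m →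
                  (N - + 2 / 1 * K) * (+ 2 / 1 * H) + (A + + 2 / 1) * (+ 2 / 1 * K - + 2 / 1 * H) + + 2 / 1 * K * (+ 2 / 1 * K)
                    < + 2 / 1 * m + + 2 / 1 * K
    edge-excess {A} {H} {m} A< H< m≥ = 0<q-p⇒p<q (subst (0ℚ <_) (sym (edge-excess-identity e N K A H m))
      (0<+ (0<* (0<* (0<* 0<2 0<e) 0<K) (p<q⇒0<q-p A<)) (0≤+ (0≤+ (0≤+
        (p≤q⇒0≤q-p m≥)
        (0≤* (0≤* (ℕ→ℚ-nonNeg 2) (<⇒≤ (p<q⇒0<q-p H<))) (0≤D A<)))
        (0≤* 0≤K (0≤+ (0≤+ (0≤+ (0≤* (ℕ→ℚ-nonNeg 4) (0≤* 0≤1-e 0≤K)) (0≤* (ℕ→ℚ-nonNeg 10) (p≤q⇒0≤q-p 16≤K)))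
                          (0≤* (ℕ→ℚ-nonNeg 6) 0≤1-e)) (ℕ→ℚ-nonNeg 155))))
        (0≤* (0≤* 0≤15/8 0≤K) 0≤sparse))))
      where
      0<2 : 0ℚ < + 2 / 1
      0<2 = ℕ→ℚ-mono-< {0} {2} (ℕ.s≤s ℕ.z≤n)
      0≤15/8 : 0ℚ ≤ + 15 / 8
      0≤15/8 = ≤ᵇ⇒≤ tt

  ceiling-nonNeg : ∀ x d → ∃ λ c → ℤ.- (ℤ.- + x ℤ./ + suc d) ≡ + c × c ℕ.* suc d ℕ.< x ℕ.+ suc d
  ceiling-nonNeg x d with ℤ.- + x ℤ./ + suc d in eq
  ... | + zero  = 0 , refl , ℕ.≤-trans (ℕ.s≤s ℕ.z≤n) (ℕ.m≤n+m (suc d) x)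
  ... | + suc a = ⊥-elim (ℤ.<-irrefl refl (ℤ.<-≤-trans -x<q*d (subst (ℤ._≤ ℤ.- + x) (cong (ℤ._* + suc d) eq)
                                                                    (ℤ.[n/d]*d≤n (ℤ.- + x) (+ suc d)))))
    where
    -x<q*d : ℤ.- + x ℤ.< + suc a ℤ.* + suc d
    -x<q*d = ℤ.≤-<-trans (ℤ.neg-mono-≤ (ℤ.+≤+ ℕ.z≤n)) (subst (+ 0 ℤ.<_) (ℤ.pos-* (suc a) (suc d)) (ℤ.+<+ (ℕ.s≤s ℕ.z≤n)))
  ... | -[1+ a ] = suc a , refl , subst (suc a ℕ.* suc d ℕ.<_) (ℕ.+-comm (suc d) x) (ℕ.+-monoʳ-< (suc d) a*d<x)
    where
    floor≡ : ℤ.- + x ℤ./ℕ suc d ≡ -[1+ a ]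
    floor≡ = trans (sym (ℤ.div-pos-is-/ℕ (ℤ.- + x) (suc d))) eq
    -[1+a]+1 : ∀ a d → (+ 1 ℤ.+ ℤ.- (+ 1 ℤ.+ a)) ℤ.* d ≡ ℤ.- (a ℤ.* d)
    -[1+a]+1 = solve-∀
    a*d<x : a ℕ.* suc d ℕ.< x
    a*d<x = ℤ.drop‿+<+ (ℤ.neg-cancel-< (subst (ℤ.- + x ℤ.<_)
      (trans (cong (λ q → ℤ.suc q ℤ.* + suc d) floor≡) (trans (-[1+a]+1 (+ a) (+ suc d)) (cong ℤ.-_ (sym (ℤ.pos-* a (suc d))))))
      (ℤ.n<s[n/ℕd]*d (ℤ.- + x) (suc d))))

  ceiling-mkℚ : ∀ x d .(c : Coprime.Coprime x (suc d)) → ⌈ mkℚ (+ x) d c ⌉ ≡ ℤ.- (ℤ.- + x ℤ./ + suc d)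
  ceiling-mkℚ zero    d _ = refl
  ceiling-mkℚ (suc x) d _ = refl

  ceiling-bound : ∀ q → 0ℚ ≤ q → ℕ→ℚ ℤ.∣ ⌈ q ⌉ ∣ < q + 1ℚ
  ceiling-bound (mkℚ -[1+ _ ] _ _) (*≤* ())
  ceiling-bound q@(mkℚ (+ x) d x⊥d) 0≤q with ceiling-nonNeg x d
  ... | c , ⌈q⌉≡c , c*d<x+d rewrite ceiling-mkℚ x d x⊥d | ⌈q⌉≡c = bound c c*d<x+d
    where
    bound : ∀ c → c ℕ.* suc d ℕ.< x ℕ.+ suc d → ℕ→ℚ c < q + 1ℚ
    bound zero    _ = ≤-<-trans 0≤q (subst (_< q + 1ℚ) (+-identityʳ q) (+-monoʳ-< q 0<1))
    bound (suc c) c*d<x+d = subst (_< q + 1ℚ) (sym (ℕ→ℚ-suc c)) (+-monoˡ-< 1ℚ c<q)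
      where
      c<q : ℕ→ℚ c < q
      c<q rewrite ℕ→ℚ-normal c = *<* (subst₂ ℤ._<_ (ℤ.pos-* c (suc d)) (sym (ℤ.*-identityʳ (+ x)))
        (ℤ.+<+ (ℕ.+-cancelˡ-< (suc d) (c ℕ.* suc d) x (subst (suc c ℕ.* suc d ℕ.<_) (ℕ.+-comm x (suc d)) c*d<x+d))))

open import Data.Bool using (Bool; true)
open import Data.Fin using (Fin)
open import Data.Integer using (∣_∣; +_; +<+)
open import Data.Nat using (ℕ; zero; suc)
import Data.Nat as ℕ
import Data.Nat.Properties as ℕ
open import Data.Nat.Combinatorics using (_P_; _C_; nC1≡n; nCk+nC[k+1]≡[n+1]C[k+1])
open import Data.Nat.Tactic.RingSolver using (solve-∀)
open import Data.Product using (Σ; _×_; _,_)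
open import Data.Rational using (ℚ; 0ℚ; 1ℚ; ½; _<_; _≤_; _+_; _-_; _*_; _/_; ceiling; *<*)
open import Data.Rational.Properties using (≤-<-trans; <⇒≤; *-monoˡ-≤-nonNeg; ≤ᵇ⇒≤; *-assoc)
open import Data.Rational.Solver using (module +-*-Solver)
open import Data.Unit using (tt)
open import Relation.Binary.PropositionalEquality
  using (_≡_; refl; sym; trans; cong; cong₂; subst; subst₂; module ≡-Reasoning)
open +-*-Solver
open Arithmetic
open MaximumMatchings using (many-maximum-matchings)

hν : ℚ → ℚ
hν ε = ε * ε * (+ 1 / 8)

hδ : ℚ → ℚ → ℚ
hδ ε ν = ε * ε * ν * (+ 1 / 16)

hν-bounds : ∀ ε → 0ℚ < ε → ε < 1ℚ → (0ℚ < hν ε) × (hν ε ≤ ½)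
hν-bounds ε 0<ε ε<1 = 0<* (0<* 0<ε 0<ε) 0<1/8 , 0≤q-p⇒p≤q (subst (0ℚ ≤_) (sym identity)
  (0≤+ 0≤3/8 (0≤* (0≤* (<⇒≤ (p<q⇒0<q-p ε<1)) (0≤+ (ℕ→ℚ-nonNeg 1) (<⇒≤ 0<ε))) (<⇒≤ 0<1/8))))
  where
  0<1/8 : 0ℚ < + 1 / 8
  0<1/8 = *<* (+<+ (ℕ.s≤s ℕ.z≤n))
  0≤3/8 : 0ℚ ≤ + 3 / 8
  0≤3/8 = ≤ᵇ⇒≤ tt
  identity : ½ - ε * ε * (+ 1 / 8) ≡ + 3 / 8 + (1ℚ - ε) * (1ℚ + ε) * (+ 1 / 8)
  identity = solve 1 (λ e → con ½ :- e :* e :* con (+ 1 / 8) := con (+ 3 / 8) :+ (con 1ℚ :- e) :* (con 1ℚ :+ e) :* con (+ 1 / 8)) refl ε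

hδ-bounds : ∀ ε ν → 0ℚ < ε → ε < 1ℚ → 0ℚ < ν → ν ≤ ½ → (0ℚ < hδ ε ν) × (hδ ε ν < 1ℚ)
hδ-bounds ε ν 0<ε ε<1 0<ν ν≤½ = 0<* (0<* (0<* 0<ε 0<ε) 0<ν) 0<1/16 , 0<q-p⇒p<q (subst (0ℚ <_) (sym identity)
  (0<+ (0<+ 0<31/32 (0≤* (p≤q⇒0≤q-p ν≤½) (<⇒≤ 0<1/16)))
       (0≤* (0≤* (0≤* (<⇒≤ (p<q⇒0<q-p ε<1)) (0≤+ (ℕ→ℚ-nonNeg 1) (<⇒≤ 0<ε))) (<⇒≤ 0<ν)) (<⇒≤ 0<1/16))))
  where
  0<1/16 : 0ℚ < + 1 / 16
  0<1/16 = *<* (+<+ (ℕ.s≤s ℕ.z≤n))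
  0<31/32 : 0ℚ < + 31 / 32
  0<31/32 = *<* (+<+ (ℕ.s≤s ℕ.z≤n))
  identity : 1ℚ - ε * ε * ν * (+ 1 / 16) ≡ + 31 / 32 + (½ - ν) * (+ 1 / 16) + (1ℚ - ε) * (1ℚ + ε) * ν * (+ 1 / 16)
  identity = solve 2 (λ e v → con 1ℚ :- e :* e :* v :* con (+ 1 / 16)
                      := con (+ 31 / 32) :+ (con ½ :- v) :* con (+ 1 / 16) :+ (con 1ℚ :- e) :* (con 1ℚ :+ e) :* v :* con (+ 1 / 16))
                     refl ε ν

2*kC2+k≡k*k : ∀ k → 2 ℕ.* (k C 2) ℕ.+ k ≡ k ℕ.* k
2*kC2+k≡k*k zero    = refl
2*kC2+k≡k*k (suc k) = begin
  2 ℕ.* (suc k C 2) ℕ.+ suc k           ≡⟨ cong (λ c → 2 ℕ.* c ℕ.+ suc k) (nCk+nC[k+1]≡[n+1]C[k+1] k 1) ⟨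
  2 ℕ.* (k C 1 ℕ.+ k C 2) ℕ.+ suc k     ≡⟨ cong (λ c → 2 ℕ.* (c ℕ.+ k C 2) ℕ.+ suc k) (nC1≡n k) ⟩
  2 ℕ.* (k ℕ.+ k C 2) ℕ.+ suc k         ≡⟨ regroup k (k C 2) ⟩
  (2 ℕ.* (k C 2) ℕ.+ k) ℕ.+ (2 ℕ.* k ℕ.+ 1) ≡⟨ cong (ℕ._+ (2 ℕ.* k ℕ.+ 1)) (2*kC2+k≡k*k k) ⟩
  k ℕ.* k ℕ.+ (2 ℕ.* k ℕ.+ 1)           ≡⟨ square-suc k ⟩
  suc k ℕ.* suc k                       ∎
  where
  open ≡-Reasoning
  regroup : ∀ k c → 2 ℕ.* (k ℕ.+ c) ℕ.+ suc k ≡ (2 ℕ.* c ℕ.+ k) ℕ.+ (2 ℕ.* k ℕ.+ 1)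
  regroup = solve-∀
  square-suc : ∀ k → k ℕ.* k ℕ.+ (2 ℕ.* k ℕ.+ 1) ≡ suc k ℕ.* suc k
  square-suc = solve-∀

mExt-sparse : ∀ {n k} → 5 ℕ.* k ℕ.+ 3 ℕ.≤ 2 ℕ.* n → mExt n k ≡ k ℕ.* (n ℕ.∸ k) ℕ.+ k C 2
mExt-sparse {n} {k} 5k+3≤2n with 5 ℕ.* k ℕ.+ 3 ℕ.≤ᵇ 2 ℕ.* n | ℕ.≤⇒≤ᵇ 5k+3≤2n
... | true | _ = refl

+1-cancel-< : ∀ {p q} → p + 1ℚ < q + 1ℚ → p < q
+1-cancel-< {p} {q} p+1<q+1 = 0<q-p⇒p<q (subst (0ℚ <_) (solve 2 (λ p q → (q :+ con 1ℚ) :- (p :+ con 1ℚ) := q :- p) refl p q)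
                                                  (p<q⇒0<q-p p+1<q+1))

module Dense (ε ν : ℚ) (n k : ℕ) (G : Graph n) (0<ε : 0ℚ < ε) (ε<1 : ε < 1ℚ) (ν<hν : ν < hν ε)
             (νn≡k : ν * ℕ→ℚ n ≡ ℕ→ℚ k) (1≤δn : 1ℚ ≤ hδ ε ν * ℕ→ℚ n)
             (dense : ℕ→ℚ (mExt n k) - hδ ε ν * (ℕ→ℚ n * ℕ→ℚ n) ≤ ℕ→ℚ (size G)) where
  N K m : ℚ
  N = ℕ→ℚ n
  K = ℕ→ℚ k
  m = ℕ→ℚ (size G)

  0≤N : 0ℚ ≤ N
  0≤N = ℕ→ℚ-nonNeg n

  0≤1-ε : 0ℚ ≤ 1ℚ - ε
  0≤1-ε = <⇒≤ (p<q⇒0<q-p ε<1)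

  sparse : + 8 / 1 * K ≤ ε * ε * N
  sparse = 0≤q-p⇒p≤q (subst (0ℚ ≤_) (sym identity) (0≤* (0≤* (ℕ→ℚ-nonNeg 8) 0≤N) (<⇒≤ (p<q⇒0<q-p ν<hν))))
    where
    identity : ε * ε * N - + 8 / 1 * K ≡ + 8 / 1 * N * (ε * ε * (+ 1 / 8) - ν)
    identity = trans (cong (λ K → ε * ε * N - + 8 / 1 * K) (sym νn≡k))
      (solve 3 (λ e v N → e :* e :* N :- con (+ 8 / 1) :* (v :* N) := con (+ 8 / 1) :* N :* (e :* e :* con (+ 1 / 8) :- v))
             refl ε ν N)

  large : + 16 / 1 ≤ ε * ε * K
  large = 0≤q-p⇒p≤q (subst (0ℚ ≤_) (sym identity) (0≤* (ℕ→ℚ-nonNeg 16) (p≤q⇒0≤q-p 1≤δn)))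
    where
    identity : ε * ε * K - + 16 / 1 ≡ + 16 / 1 * (hδ ε ν * N - 1ℚ)
    identity = trans (cong (λ K → ε * ε * K - + 16 / 1) (sym νn≡k))
      (solve 3 (λ e v N → e :* e :* (v :* N) :- con (+ 16 / 1) := con (+ 16 / 1) :* (e :* e :* v :* con (+ 1 / 16) :* N :- con 1ℚ))
             refl ε ν N)

  open Regime 0<ε ε<1 0≤N (ℕ→ℚ-nonNeg k) sparse large

  2k≤n : 2 ℕ.* k ℕ.≤ n
  2k≤n = ℕ→ℚ-cancel-≤ (subst (_≤ N) (sym (ℕ→ℚ-* 2 k)) 2K≤N)

  5k+3≤2n : 5 ℕ.* k ℕ.+ 3 ℕ.≤ 2 ℕ.* n
  5k+3≤2n = ℕ→ℚ-cancel-≤ (subst₂ _≤_ (sym (trans (ℕ→ℚ-+ (5 ℕ.* k) 3) (cong (_+ + 3 / 1) (ℕ→ℚ-* 5 k)))) (sym (ℕ→ℚ-* 2 n)) 5K+3≤2N)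

  twice-mExt : + 2 / 1 * ℕ→ℚ (mExt n k) ≡ + 2 / 1 * K * (N - K) + K * K - K
  twice-mExt = begin
    + 2 / 1 * ℕ→ℚ (mExt n k)                              ≡⟨ solve 2 (λ x K → x := (x :+ K) :- K) refl (+ 2 / 1 * ℕ→ℚ (mExt n k)) K ⟩
    + 2 / 1 * ℕ→ℚ (mExt n k) + K - K                      ≡⟨ cong (λ x → x + K - K) (ℕ→ℚ-* 2 (mExt n k)) ⟨
    ℕ→ℚ (2 ℕ.* mExt n k) + K - K                          ≡⟨ cong (_- K) (ℕ→ℚ-+ (2 ℕ.* mExt n k) k) ⟨
    ℕ→ℚ (2 ℕ.* mExt n k ℕ.+ k) - K                        ≡⟨ cong (λ x → ℕ→ℚ x - K) 2mExt+k ⟩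
    ℕ→ℚ (2 ℕ.* (k ℕ.* (n ℕ.∸ k)) ℕ.+ k ℕ.* k) - K         ≡⟨ cong (_- K) cast ⟩
    + 2 / 1 * K * (N - K) + K * K - K                     ∎
    where
    open ≡-Reasoning
    k≤n : k ℕ.≤ n
    k≤n = ℕ.≤-trans (ℕ.m≤n*m k 2) 2k≤n
    2mExt+k : 2 ℕ.* mExt n k ℕ.+ k ≡ 2 ℕ.* (k ℕ.* (n ℕ.∸ k)) ℕ.+ k ℕ.* k
    2mExt+k = begin
      2 ℕ.* mExt n k ℕ.+ k                               ≡⟨ cong (λ x → 2 ℕ.* x ℕ.+ k) (mExt-sparse {n} {k} 5k+3≤2n) ⟩
      2 ℕ.* (k ℕ.* (n ℕ.∸ k) ℕ.+ k C 2) ℕ.+ k            ≡⟨ regroup (k ℕ.* (n ℕ.∸ k)) (k C 2) k ⟩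
      2 ℕ.* (k ℕ.* (n ℕ.∸ k)) ℕ.+ (2 ℕ.* (k C 2) ℕ.+ k)  ≡⟨ cong (2 ℕ.* (k ℕ.* (n ℕ.∸ k)) ℕ.+_) (2*kC2+k≡k*k k) ⟩
      2 ℕ.* (k ℕ.* (n ℕ.∸ k)) ℕ.+ k ℕ.* k                ∎
      where
      regroup : ∀ a c k → 2 ℕ.* (a ℕ.+ c) ℕ.+ k ≡ 2 ℕ.* a ℕ.+ (2 ℕ.* c ℕ.+ k)
      regroup = solve-∀
    cast : ℕ→ℚ (2 ℕ.* (k ℕ.* (n ℕ.∸ k)) ℕ.+ k ℕ.* k) ≡ + 2 / 1 * K * (N - K) + K * K
    cast = trans (ℕ→ℚ-+ (2 ℕ.* (k ℕ.* (n ℕ.∸ k))) (k ℕ.* k)) (cong₂ _+_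
      (trans (ℕ→ℚ-* 2 (k ℕ.* (n ℕ.∸ k))) (trans (cong (+ 2 / 1 *_) (trans (ℕ→ℚ-* k (n ℕ.∸ k)) (cong (K *_) (ℕ→ℚ-∸ n k k≤n))))
                                (sym (*-assoc (+ 2 / 1) K (N - K)))))
      (ℕ→ℚ-* k k))

  many-edges : + 2 / 1 * K * (N - K) + K * K - K - ε * ε * K * N * (+ 1 / 8) ≤ + 2 / 1 * m
  many-edges = subst (_≤ + 2 / 1 * m) identity (*-monoˡ-≤-nonNeg (+ 2 / 1) dense)
    where
    identity : + 2 / 1 * (ℕ→ℚ (mExt n k) - hδ ε ν * (N * N)) ≡ + 2 / 1 * K * (N - K) + K * K - K - ε * ε * K * N * (+ 1 / 8)
    identity = begin
      + 2 / 1 * (ℕ→ℚ (mExt n k) - hδ ε ν * (N * N))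
        ≡⟨ solve 4 (λ x e v N → con (+ 2 / 1) :* (x :- e :* e :* v :* con (+ 1 / 16) :* (N :* N))
                                 := con (+ 2 / 1) :* x :- e :* e :* (v :* N) :* N :* con (+ 1 / 8)) refl (ℕ→ℚ (mExt n k)) ε ν N ⟩
      + 2 / 1 * ℕ→ℚ (mExt n k) - ε * ε * (ν * N) * N * (+ 1 / 8)
        ≡⟨ cong₂ (λ x K → x - ε * ε * K * N * (+ 1 / 8)) twice-mExt νn≡k ⟩
      + 2 / 1 * K * (N - K) + K * K - K - ε * ε * K * N * (+ 1 / 8) ∎
      where open ≡-Reasoning

  A B : ℕ
  A = ∣ ⌈ (1ℚ - ε) * N ⌉ ∣
  B = ∣ ⌈ (1ℚ - ε) * K ⌉ ∣

  A< : ℕ→ℚ A < (1ℚ - ε) * N + 1ℚ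
  A< = ceiling-bound _ (0≤* 0≤1-ε 0≤N)

  below-B : ∀ {H} → H ℕ.< B → ℕ→ℚ H < (1ℚ - ε) * K
  below-B {H} H<B = +1-cancel-< (≤-<-trans (subst (_≤ ℕ→ℚ B) (ℕ→ℚ-suc H) (ℕ→ℚ-mono-≤ H<B))
                                            (ceiling-bound _ (0≤* 0≤1-ε (ℕ→ℚ-nonNeg k))))

  too-many-edges : ∀ H L → L ℕ.+ 2 ℕ.* H ≡ 2 ℕ.* k → H ℕ.< B →
                   (n ℕ.∸ 2 ℕ.* k) ℕ.* (2 ℕ.* H) ℕ.+ (A ℕ.+ 2) ℕ.* L ℕ.+ 2 ℕ.* k ℕ.* (2 ℕ.* k) ℕ.< 2 ℕ.* size G ℕ.+ 2 ℕ.* k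
  too-many-edges H L L+2H≡2k H<B = ℕ→ℚ-cancel-< (subst₂ _<_ (sym lhs) (sym rhs) (edge-excess {ℕ→ℚ A} {ℕ→ℚ H} {m} A< (below-B H<B) many-edges))
    where
    L≡ : ℕ→ℚ L ≡ + 2 / 1 * K - + 2 / 1 * ℕ→ℚ H
    L≡ = begin
      ℕ→ℚ L                                         ≡⟨ solve 2 (λ c h → c := c :+ h :- h) refl (ℕ→ℚ L) (ℕ→ℚ (2 ℕ.* H)) ⟩
      ℕ→ℚ L + ℕ→ℚ (2 ℕ.* H) - ℕ→ℚ (2 ℕ.* H)          ≡⟨ cong₂ _-_ (trans (sym (ℕ→ℚ-+ L (2 ℕ.* H))) (cong ℕ→ℚ L+2H≡2k)) refl ⟩
      ℕ→ℚ (2 ℕ.* k) - ℕ→ℚ (2 ℕ.* H)                  ≡⟨ cong₂ _-_ (ℕ→ℚ-* 2 k) (ℕ→ℚ-* 2 H) ⟩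
      + 2 / 1 * K - + 2 / 1 * ℕ→ℚ H                  ∎
      where open ≡-Reasoning
    lhs : ℕ→ℚ ((n ℕ.∸ 2 ℕ.* k) ℕ.* (2 ℕ.* H) ℕ.+ (A ℕ.+ 2) ℕ.* L ℕ.+ 2 ℕ.* k ℕ.* (2 ℕ.* k))
        ≡ (N - + 2 / 1 * K) * (+ 2 / 1 * ℕ→ℚ H) + (ℕ→ℚ A + + 2 / 1) * (+ 2 / 1 * K - + 2 / 1 * ℕ→ℚ H)
          + + 2 / 1 * K * (+ 2 / 1 * K)
    lhs = trans (ℕ→ℚ-+ ((n ℕ.∸ 2 ℕ.* k) ℕ.* (2 ℕ.* H) ℕ.+ (A ℕ.+ 2) ℕ.* L) (2 ℕ.* k ℕ.* (2 ℕ.* k))) (cong₂ _+_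
      (trans (ℕ→ℚ-+ ((n ℕ.∸ 2 ℕ.* k) ℕ.* (2 ℕ.* H)) ((A ℕ.+ 2) ℕ.* L)) (cong₂ _+_
        (trans (ℕ→ℚ-* (n ℕ.∸ 2 ℕ.* k) (2 ℕ.* H))
               (cong₂ _*_ (trans (ℕ→ℚ-∸ n (2 ℕ.* k) 2k≤n) (cong (N -_) (ℕ→ℚ-* 2 k))) (ℕ→ℚ-* 2 H)))
        (trans (ℕ→ℚ-* (A ℕ.+ 2) L) (cong₂ _*_ (ℕ→ℚ-+ A 2) L≡))))
      (trans (ℕ→ℚ-* (2 ℕ.* k) (2 ℕ.* k)) (cong₂ _*_ (ℕ→ℚ-* 2 k) (ℕ→ℚ-* 2 k))))
    rhs : ℕ→ℚ (2 ℕ.* size G ℕ.+ 2 ℕ.* k) ≡ + 2 / 1 * m + + 2 / 1 * K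
    rhs = trans (ℕ→ℚ-+ (2 ℕ.* size G) (2 ℕ.* k)) (cong₂ _+_ (ℕ→ℚ-* 2 (size G)) (ℕ→ℚ-* 2 k))

theorem2 :
    Σ (ℚ → ℚ) λ hν → Σ (ℚ → ℚ → ℚ) λ hδ →
      (∀ ε → 0ℚ < ε → ε < 1ℚ → (0ℚ < hν ε) × (hν ε ≤ ½))
      × (∀ ε ν → 0ℚ < ε → ε < 1ℚ → 0ℚ < ν → ν ≤ ½ → (0ℚ < hδ ε ν) × (hδ ε ν < 1ℚ))
      × (∀ (ε ν : ℚ) (n k : ℕ) (G : Graph n) →
          0ℚ < ε → ε < 1ℚ → 0ℚ < ν → ν < hν ε →
          ν * ℕ→ℚ n ≡ ℕ→ℚ k →
          HasMatchingNumber G k →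
          1ℚ ≤ hδ ε ν * ℕ→ℚ n →
          ℕ→ℚ (mExt n k) - hδ ε ν * (ℕ→ℚ n * ℕ→ℚ n) ≤ ℕ→ℚ (size G) →
          Σ (Fin (∣ ⌈ (1ℚ - ε) * ℕ→ℚ n ⌉ ∣ P ∣ ⌈ (1ℚ - ε) * ℕ→ℚ k ⌉ ∣) → (Fin n → Fin n → Bool)) λ f →
            (∀ i → IsMaximumMatching G (f i))
            × (∀ i j → (∀ u v → f i u v ≡ f j u v) → i ≡ j))
theorem2 = hν , hδ , hν-bounds , hδ-bounds , λ ε ν n k G 0<ε ε<1 _ ν<hν νn≡k hm 1≤δn dense →
  let open Dense ε ν n k G 0<ε ε<1 ν<hν νn≡k 1≤δn dense
  in many-maximum-matchings G hm A B too-many-edges
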